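{- Let $\mathbb{F}$ be the finite field with $q$ elements, let $b\ge1$, let $\tau$ be a $b$-ball juggling state, and let $N$ be an integer greater than the largest element of $\tau$. Then the fraction of $b\times N$ matrices over $\mathbb{F}$ (columns indexed $0,\dots,N-1$) whose set of pivot columns equals $\tau$ is $$\frac{|GL_b(\mathbb{F})|}{q^{b^2}}\cdot q^{ -\ell(\tau)},$$ which is independent of $N$.
   Context: A $b$-ball juggling state is a $b$-element subset of $\mathbb{N}=\{0,1,2,\dots\}$, drawn as a word in $\times$ (positions in the subset) and $-$ (other positions). Column $i$ of a matrix with columns $\vec c_0,\vec c_1,\dots$ is a pivot column if $\vec c_i$ is not in the span of $\vec c_0,\dots,\vec c_{i-1}$. For a juggling state $\tau$, $\ell(\tau)$ is the number of pairs $i<j$ of positions with $i\notin\tau$ and $j\in\tau$ (pairs $\ldots-\ldots\times\ldots$). -}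

module Defs where

open import Level using (Level; _⊔_) renaming (suc to lsuc)
open import Algebra.Bundles using (CommutativeRing)
open import Function.Bundles using (Inverse)
open import Data.Nat as ℕ using (ℕ; zero; suc; _<_; _≡ᵇ_; _<ᵇ_)
open import Data.Fin as Fin using (Fin; toℕ)
import Data.Fin.Properties as FinP
open import Data.List as List using (List; []; _∷_; length; filter; map; allFin; upTo; concatMap)
open import Data.Bool.ListAction using (any; all)
open import Data.Nat.ListAction using (sum)
open import Data.List.Relation.Unary.Linked using (Linked)
open import Data.List.Relation.Unary.All using (All)
open import Data.Bool using (Bool; true; false; not; _∧_)
import Data.Bool as B
import Data.Bool.Properties as BP
open import Data.Product using (∃; _,_)
open import Relation.Nullary using (¬_; Dec; yes; no; does)
open import Relation.Binary.PropositionalEquality as ≡ using (_≡_)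
import Relation.Binary.Reasoning.Setoid as SetoidReasoning

_⇔ᵇ_ : Bool → Bool → Bool
x ⇔ᵇ y = not (x B.xor y)

_∈ᵇ_ : ℕ → List ℕ → Bool
i ∈ᵇ τ = any (λ x → x ≡ᵇ i) τ

record FiniteField (c ℓ : Level) (q : ℕ) : Set (lsuc (c ⊔ ℓ)) where
  field
    commRing  : CommutativeRing c ℓ
  open CommutativeRing commRing public
  field
    0≉1       : ¬ (0# ≈ 1#)
    inverse   : ∀ x → ¬ (x ≈ 0#) → ∃ λ y → x * y ≈ 1#
    card      : Inverse setoid (≡.setoid (Fin q))

  open Inverse card using (to; from; to-cong; strictlyInverseʳ; from-cong)

  _≟_ : ∀ x y → Dec (x ≈ y)
  x ≟ y with to x Fin.≟ to y
  ... | yes p = yes (begin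
          x             ≈⟨ sym (strictlyInverseʳ x) ⟩
          from (to x)   ≈⟨ from-cong p ⟩
          from (to y)   ≈⟨ strictlyInverseʳ y ⟩
          y             ∎)
    where open SetoidReasoning setoid
  ... | no ¬p = no (λ e → ¬p (to-cong e))

  _==_ : Carrier → Carrier → Bool
  x == y = does (x ≟ y)

  elements : List Carrier
  elements = map from (allFin q)

  allFuns : ∀ {a} {A : Set a} → List A → (n : ℕ) → List (Fin n → A)
  allFuns xs zero    = (λ ()) ∷ []
  allFuns xs (suc n) =
    concatMap (λ x → map (λ f → λ { Fin.zero → x ; (Fin.suc i) → f i })
                         (allFuns xs n)) xs

  Σ : (n : ℕ) → (Fin n → Carrier) → Carrier
  Σ zero    f = 0#
  Σ (suc n) f = f Fin.zero + Σ n (λ i → f (Fin.suc i))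

  Vector : ℕ → Set c
  Vector b = Fin b → Carrier

  -- b × N matrices: M r i is the entry in row r, column i
  Matrix : ℕ → ℕ → Set c
  Matrix b N = Fin b → Fin N → Carrier

  allMatrices : (b N : ℕ) → List (Matrix b N)
  allMatrices b N = allFuns (allFuns elements N) b

  vecEq : ∀ {b} → Vector b → Vector b → Bool
  vecEq {b} u v = all (λ r → u r == v r) (allFin b)

  inSpan : ∀ {b} (k : ℕ) → (Fin k → Vector b) → Vector b → Bool
  inSpan {b} k w v =
    any (λ a → vecEq (λ r → Σ k (λ j → a j * w j r)) v) (allFuns elements k)

  column : ∀ {b N} → Matrix b N → Fin N → Vector b
  column M i r = M r i

  isPivot : ∀ {b N} → Matrix b N → Fin N → Bool
  isPivot M i =
    not (inSpan (toℕ i) (λ j → column M (Fin.inject j)) (column M i))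

  _⊗_ : ∀ {b} → Matrix b b → Matrix b b → Matrix b b
  _⊗_ {b} A B r s = Σ b (λ k → A r k * B k s)

  I : ∀ {b} → Matrix b b
  I r s = if-eq r s
    where
      if-eq : ∀ {b} → Fin b → Fin b → Carrier
      if-eq r s with r Fin.≟ s
      ... | yes _ = 1#
      ... | no  _ = 0#

  matEq : ∀ {b} → Matrix b b → Matrix b b → Bool
  matEq {b} A B = all (λ r → vecEq (A r) (B r)) (allFin b)

  isInvertible : ∀ {b} → Matrix b b → Bool
  isInvertible {b} A =
    any (λ B → matEq (A ⊗ B) I ∧ matEq (B ⊗ A) I) (allMatrices b b)

  cardGL : ℕ → ℕ
  cardGL b = length (filter (λ A → isInvertible A BP.≟ true) (allMatrices b b))

  countPivotSet : (b N : ℕ) → List ℕ → ℕ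
  countPivotSet b N τ =
    length (filter (λ M → all (λ i → isPivot M i ⇔ᵇ (toℕ i ∈ᵇ τ)) (allFin N) BP.≟ true)
                   (allMatrices b N))

record JugglingState (b : ℕ) : Set where
  field
    elems      : List ℕ
    increasing : Linked _<_ elems
    size       : length elems ≡ b

-- ℓ(τ) = #{(i , j) : i < j, i ∉ τ, j ∈ τ}
ℓ : List ℕ → ℕ
ℓ τ = sum (map (λ j → length (filter (λ i → not (i ∈ᵇ τ) BP.≟ true) (upTo j))) τ)

module Submission where

-- Scan a b × N matrix column by column.  If the columns before position N
-- have k pivots, they span q^k vectors, so column N can be chosen in
-- q^b − q^k ways if it is to be a pivot and in q^k ways otherwise.  Hence
-- the number of matrices with pivot set τ is the product pivotCount of
-- these factors.

open import Defs
open import Level using (Level)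
open import Data.Nat using (ℕ; _*_; _^_; _≤_; _<_)
open import Data.List.Relation.Unary.All using (All)
open import Relation.Binary.PropositionalEquality using (_≡_)

open import Data.Nat as ℕ using (zero; suc; _+_; _∸_; s≤s; z≤n; _≡ᵇ_)
import Data.Nat.Properties as ℕP
open import Data.Fin as Fin using (Fin; toℕ; fromℕ; fromℕ<; inject₁)
import Data.Fin.Properties as FinP
open import Data.List using (List; []; _∷_; length; filter; map; concatMap; _++_; allFin; tabulate; upTo)
import Data.List.Properties as ListP
open import Data.List.Relation.Unary.All using ([]; _∷_)
open import Data.List.Relation.Unary.Linked as Linked using (Linked; []; _∷_)
open import Data.List.Relation.Unary.Any using (here; there)
open import Data.List.Membership.Propositional using (_∈_)
open import Data.List.Membership.Propositional.Properties using (∈-upTo⁺)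
open import Data.Bool using (Bool; true; false; not; _∧_; if_then_else_; T)
import Data.Bool.Properties as BoolP
open import Data.Bool.ListAction using (and; or; any; all)
open import Data.Nat.ListAction using (sum)
import Data.Nat.ListAction.Properties as SumP
open import Data.Product using (Σ; ∃; _,_; proj₁; proj₂; _×_)
open import Data.Sum using (inj₁; inj₂)
open import Data.Empty using (⊥-elim)
open import Function using (_∘_)
open import Function.Bundles using (Inverse)
open import Relation.Nullary using (¬_; Dec; yes; no; does)
open import Relation.Binary.PropositionalEquality
  using (_≢_; refl; cong; cong₂; sym; trans; subst; module ≡-Reasoning)
open import Data.Nat.Solver using (module +-*-Solver)
open +-*-Solver using (solve; _:+_; _:*_; _:=_; con)
open import Algebra.Properties.CommutativeSemigroup ℕP.+-commutativeSemigroup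
  using () renaming (interchange to +-interchange)

private
  variable
    α β : Level
    A : Set α
    B : Set β

bool-⇔ : ∀ {x y : Bool} → (x ≡ true → y ≡ true) → (y ≡ true → x ≡ true) → x ≡ y
bool-⇔ {true}  {true}  _ _ = refl
bool-⇔ {true}  {false} f _ = sym (f refl)
bool-⇔ {false} {true}  _ g = g refl
bool-⇔ {false} {false} _ _ = refl

true≢false : true ≢ false
true≢false ()

∧-elim : ∀ {x y} → x ∧ y ≡ true → x ≡ true × y ≡ true
∧-elim {true} {true} _ = refl , refl

∧-intro : ∀ {x y} → x ≡ true → y ≡ true → x ∧ y ≡ true
∧-intro refl refl = refl

dec-true : {P : Set α} (d : Dec P) → does d ≡ true → P
dec-true (yes p) _ = p

dec-intro : {P : Set α} (d : Dec P) → P → does d ≡ true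
dec-intro (yes _) _ = refl
dec-intro (no ¬p) p = ⊥-elim (¬p p)

≡ᵇ-refl : ∀ n → (n ≡ᵇ n) ≡ true
≡ᵇ-refl zero    = refl
≡ᵇ-refl (suc n) = ≡ᵇ-refl n

≡ᵇ-false : ∀ m n → m ≢ n → (m ≡ᵇ n) ≡ false
≡ᵇ-false zero    zero    m≢n = ⊥-elim (m≢n refl)
≡ᵇ-false zero    (suc n) _   = refl
≡ᵇ-false (suc m) zero    _   = refl
≡ᵇ-false (suc m) (suc n) m≢n = ≡ᵇ-false m n (m≢n ∘ cong suc)

⇔ᵇ-true : ∀ x → (x ⇔ᵇ true) ≡ x
⇔ᵇ-true true  = refl
⇔ᵇ-true false = refl

⇔ᵇ-false : ∀ x → (not x ⇔ᵇ false) ≡ x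
⇔ᵇ-false true  = refl
⇔ᵇ-false false = refl

∈⇒∈ᵇ : ∀ {m xs} → m ∈ xs → m ∈ᵇ xs ≡ true
∈⇒∈ᵇ {m} (here refl) rewrite ≡ᵇ-refl m = refl
∈⇒∈ᵇ {m} (there {x} m∈xs) rewrite ∈⇒∈ᵇ m∈xs = BoolP.∨-zeroʳ (x ≡ᵇ m)

χ : Bool → ℕ
χ true  = 1
χ false = 0

∑ : (A → ℕ) → List A → ℕ
∑ f xs = sum (map f xs)

count≡∑χ : (p : A → Bool) (xs : List A) →
           length (filter (λ x → p x BoolP.≟ true) xs) ≡ ∑ (χ ∘ p) xs
count≡∑χ p []       = refl
count≡∑χ p (x ∷ xs) with p x
... | true  = cong suc (count≡∑χ p xs)
... | false = count≡∑χ p xs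

χ-∧ : ∀ x y → χ (x ∧ y) ≡ χ x * χ y
χ-∧ true  y = sym (ℕP.+-identityʳ (χ y))
χ-∧ false y = refl

∑χ-not+∑χ : (p : A → Bool) (xs : List A) → ∑ (χ ∘ not ∘ p) xs + ∑ (χ ∘ p) xs ≡ length xs
∑χ-not+∑χ p []       = refl
∑χ-not+∑χ p (x ∷ xs) with p x
... | true  = trans (ℕP.+-suc _ _) (cong suc (∑χ-not+∑χ p xs))
... | false = cong suc (∑χ-not+∑χ p xs)

∑-cong : {f g : A → ℕ} (xs : List A) → (∀ x → f x ≡ g x) → ∑ f xs ≡ ∑ g xs
∑-cong []       e = refl
∑-cong (x ∷ xs) e = cong₂ _+_ (e x) (∑-cong xs e)

∑-mono : {f g : A → ℕ} (xs : List A) → (∀ x → f x ≤ g x) → ∑ f xs ≤ ∑ g xs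
∑-mono []       h = z≤n
∑-mono (x ∷ xs) h = ℕP.+-mono-≤ (h x) (∑-mono xs h)

∑-+ : (f g : A → ℕ) (xs : List A) → ∑ (λ x → f x + g x) xs ≡ ∑ f xs + ∑ g xs
∑-+ f g []       = refl
∑-+ f g (x ∷ xs) = trans (cong (f x + g x +_) (∑-+ f g xs)) (+-interchange (f x) (g x) _ _)

∑-*ˡ : (c : ℕ) (f : A → ℕ) (xs : List A) → ∑ (λ x → c * f x) xs ≡ c * ∑ f xs
∑-*ˡ c f []       = sym (ℕP.*-zeroʳ c)
∑-*ˡ c f (x ∷ xs) = trans (cong (c * f x +_) (∑-*ˡ c f xs)) (sym (ℕP.*-distribˡ-+ c (f x) _))

∑-const : (c : ℕ) (xs : List A) → ∑ (λ _ → c) xs ≡ length xs * c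
∑-const c []       = refl
∑-const c (x ∷ xs) = cong (c +_) (∑-const c xs)

∑-map : (f : B → ℕ) (g : A → B) (xs : List A) → ∑ f (map g xs) ≡ ∑ (f ∘ g) xs
∑-map f g xs = cong sum (sym (ListP.map-∘ xs))

∑-concatMap : (f : B → ℕ) (g : A → List B) (xs : List A) →
              ∑ f (concatMap g xs) ≡ ∑ (λ x → ∑ f (g x)) xs
∑-concatMap f g []       = refl
∑-concatMap f g (x ∷ xs) = begin
  sum (map f (g x ++ concatMap g xs))      ≡⟨ cong sum (ListP.map-++ f (g x) _) ⟩
  sum (map f (g x) ++ map f (concatMap g xs)) ≡⟨ SumP.sum-++ (map f (g x)) _ ⟩
  ∑ f (g x) + ∑ f (concatMap g xs)         ≡⟨ cong (∑ f (g x) +_) (∑-concatMap f g xs) ⟩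
  ∑ f (g x) + ∑ (λ y → ∑ f (g y)) xs       ∎
  where open ≡-Reasoning

∑-swap : (f : A → B → ℕ) (xs : List A) (ys : List B) →
         ∑ (λ x → ∑ (f x) ys) xs ≡ ∑ (λ y → ∑ (λ x → f x y) xs) ys
∑-swap f []       ys = sym (trans (∑-const 0 ys) (ℕP.*-zeroʳ (length ys)))
∑-swap f (x ∷ xs) ys = trans (cong (∑ (f x) ys +_) (∑-swap f xs ys))
                             (sym (∑-+ (f x) (λ y → ∑ (λ x' → f x' y) xs) ys))

length≡∑1 : (xs : List A) → length xs ≡ ∑ (λ _ → 1) xs
length≡∑1 xs = sym (trans (∑-const 1 xs) (ℕP.*-identityʳ _))

any-witness : {p : A → Bool} {xs : List A} → any p xs ≡ true → ∃ λ x → p x ≡ true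
any-witness {p = p} {x ∷ xs} e with p x in px
... | true  = x , px
... | false = any-witness {xs = xs} e

any⇒∑χ-positive : {p : A → Bool} {xs : List A} → any p xs ≡ true → 0 < ∑ (χ ∘ p) xs
any⇒∑χ-positive {p = p} {x ∷ xs} e with p x
... | true  = s≤s z≤n
... | false = any⇒∑χ-positive {xs = xs} e

-- All
-- the counting in this file compares different enumerations of the same
-- finite set (matrices row by row versus column by column, for instance).

module _ (eq : A → A → Bool) where

  Enumerates : List A → Set _
  Enumerates xs = ∀ x → ∑ (χ ∘ eq x) xs ≡ 1

  Respects : (A → Bool) → Set _
  Respects p = ∀ x y → eq x y ≡ true → p x ≡ p y

  any-enumeration : {xs : List A} → Enumerates xs → {p : A → Bool} → Respects p →
                    ∀ y → p y ≡ true → any p xs ≡ true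
  any-enumeration {xs} enum {p} resp y py = go xs (subst (0 <_) (sym (enum y)) (s≤s z≤n))
    where
      go : ∀ zs → 0 < ∑ (χ ∘ eq y) zs → any p zs ≡ true
      go (z ∷ zs) pos with eq y z in e
      ... | true  rewrite sym (resp y z e) | py = refl
      ... | false with p z
      ...   | true  = refl
      ...   | false = go zs pos

  -- the number of entries satisfying an eq-invariant predicate is the same
  -- for every enumeration (double counting the pairs (x , y) with eq x y)
  count-enumeration-invariant :
    (∀ x y → eq x y ≡ eq y x) → {p : A → Bool} → Respects p →
    (xs ys : List A) → Enumerates xs → Enumerates ys → ∑ (χ ∘ p) xs ≡ ∑ (χ ∘ p) ys
  count-enumeration-invariant eq-sym {p} resp xs ys enum-xs enum-ys = begin
    ∑ (χ ∘ p) xs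
      ≡⟨ ∑-cong xs (λ x → sym (trans (cong (χ (p x) *_) (enum-ys x)) (ℕP.*-identityʳ _))) ⟩
    ∑ (λ x → χ (p x) * ∑ (χ ∘ eq x) ys) xs
      ≡⟨ ∑-cong xs (λ x → sym (∑-*ˡ (χ (p x)) _ ys)) ⟩
    ∑ (λ x → ∑ (λ y → χ (p x) * χ (eq x y)) ys) xs
      ≡⟨ ∑-cong xs (λ x → ∑-cong ys (pair-symmetric x)) ⟩
    ∑ (λ x → ∑ (λ y → χ (p y) * χ (eq y x)) ys) xs
      ≡⟨ ∑-swap (λ x y → χ (p y) * χ (eq y x)) xs ys ⟩
    ∑ (λ y → ∑ (λ x → χ (p y) * χ (eq y x)) xs) ys
      ≡⟨ ∑-cong ys (λ y → ∑-*ˡ (χ (p y)) _ xs) ⟩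
    ∑ (λ y → χ (p y) * ∑ (χ ∘ eq y) xs) ys
      ≡⟨ ∑-cong ys (λ y → trans (cong (χ (p y) *_) (enum-xs y)) (ℕP.*-identityʳ _)) ⟩
    ∑ (χ ∘ p) ys ∎
    where
      open ≡-Reasoning
      pair-symmetric : ∀ x y → χ (p x) * χ (eq x y) ≡ χ (p y) * χ (eq y x)
      pair-symmetric x y with eq x y in e
      ... | true  rewrite resp x y e | sym (eq-sym x y) | e = refl
      ... | false rewrite sym (eq-sym x y) | e =
        trans (ℕP.*-zeroʳ (χ (p x))) (sym (ℕP.*-zeroʳ (χ (p y))))

  full-count⇒all : {xs : List A} → Enumerates xs → {p : A → Bool} → Respects p →
                   ∑ (χ ∘ p) xs ≡ length xs → ∀ y → p y ≡ true
  full-count⇒all {xs} enum {p} resp full y with p y in py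
  ... | true  = refl
  ... | false = ⊥-elim (ℕP.<-irrefl (sym none-fail) (any⇒∑χ-positive {xs = xs} some-fails))
    where
      none-fail : ∑ (χ ∘ not ∘ p) xs ≡ 0
      none-fail = ℕP.+-cancelʳ-≡ _ _ 0 (trans (∑χ-not+∑χ p xs) (sym full))
      some-fails : any (not ∘ p) xs ≡ true
      some-fails = any-enumeration {xs} enum (λ x y e → cong not (resp x y e)) y (cong not py)

  χ-any-unique : (∀ x → eq x x ≡ true) → {xs : List A} → Enumerates xs →
                 {p : A → Bool} → (∀ x y → p x ≡ true → p y ≡ true → eq x y ≡ true) →
                 χ (any p xs) ≡ ∑ (χ ∘ p) xs
  χ-any-unique eq-refl {xs} enum {p} unique = go xs (ℕP.≤-reflexive ∘ enum)
    where
      go : ∀ zs → (∀ y → ∑ (χ ∘ eq y) zs ≤ 1) → χ (any p zs) ≡ ∑ (χ ∘ p) zs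
      go []       _    = refl
      go (z ∷ zs) once with p z in pz
      ... | true  = cong suc (sym (ℕP.n≤0⇒n≡0 rest-empty))
        where
          z-once : 1 + ∑ (χ ∘ eq z) zs ≤ 1
          z-once = subst (λ k → k + ∑ (χ ∘ eq z) zs ≤ 1) (cong χ (eq-refl z)) (once z)
          p⇒eq-z : ∀ y → χ (p y) ≤ χ (eq z y)
          p⇒eq-z y with p y in py
          ... | false = z≤n
          ... | true  rewrite unique z y pz py = ℕP.≤-refl
          rest-empty : ∑ (χ ∘ p) zs ≤ 0
          rest-empty = ℕP.≤-trans (∑-mono zs p⇒eq-z) (ℕP.+-cancelˡ-≤ 1 _ 0 z-once)
      ... | false = go zs (λ y → ℕP.≤-trans (ℕP.m≤n+m _ (χ (eq y z))) (once y))

all-allFin : ∀ {n} (h : Fin n → Bool) → all h (allFin n) ≡ and (tabulate h)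
all-allFin h = cong and (ListP.map-tabulate (λ i → i) h)

and-tabulate⁻ : ∀ {n} (h : Fin n → Bool) → and (tabulate h) ≡ true → ∀ i → h i ≡ true
and-tabulate⁻ h e Fin.zero    = proj₁ (∧-elim {h Fin.zero} e)
and-tabulate⁻ h e (Fin.suc i) = and-tabulate⁻ (h ∘ Fin.suc) (proj₂ (∧-elim {h Fin.zero} e)) i

and-tabulate⁺ : ∀ {n} (h : Fin n → Bool) → (∀ i → h i ≡ true) → and (tabulate h) ≡ true
and-tabulate⁺ {zero}  h f = refl
and-tabulate⁺ {suc n} h f = ∧-intro (f Fin.zero) (and-tabulate⁺ (h ∘ Fin.suc) (f ∘ Fin.suc))

all-allFin⁻ : ∀ {n} {h : Fin n → Bool} → all h (allFin n) ≡ true → ∀ i → h i ≡ true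
all-allFin⁻ {h = h} e = and-tabulate⁻ h (trans (sym (all-allFin h)) e)

all-allFin⁺ : ∀ {n} {h : Fin n → Bool} → (∀ i → h i ≡ true) → all h (allFin n) ≡ true
all-allFin⁺ {h = h} f = trans (all-allFin h) (and-tabulate⁺ h f)

all-allFin-cong : ∀ {n} {h h' : Fin n → Bool} → (∀ i → h i ≡ h' i) →
                  all h (allFin n) ≡ all h' (allFin n)
all-allFin-cong e = bool-⇔ (λ t → all-allFin⁺ (λ i → trans (sym (e i)) (all-allFin⁻ t i)))
                           (λ t → all-allFin⁺ (λ i → trans (e i) (all-allFin⁻ t i)))

∑-allFin-suc : ∀ {n} (f : Fin (suc n) → ℕ) →
               ∑ f (allFin (suc n)) ≡ f Fin.zero + ∑ (f ∘ Fin.suc) (allFin n)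
∑-allFin-suc f = cong (f Fin.zero +_)
  (trans (cong (∑ f) (sym (ListP.map-tabulate (λ i → i) Fin.suc))) (∑-map f Fin.suc (allFin _)))

allFin-enumerates : ∀ n → Enumerates (λ i j → does (i Fin.≟ j)) (allFin n)
allFin-enumerates (suc n) Fin.zero = trans (∑-allFin-suc {n} (λ j → χ (does (Fin.zero Fin.≟ j))))
  (cong suc (trans (∑-const 0 (allFin n)) (ℕP.*-zeroʳ (length (allFin n)))))
allFin-enumerates (suc n) (Fin.suc k) =
  trans (∑-allFin-suc {n} (λ j → χ (does (Fin.suc k Fin.≟ j)))) (allFin-enumerates n k)

allBelow : ℕ → (ℕ → Bool) → Bool
allBelow zero    h = true
allBelow (suc N) h = allBelow N h ∧ h N

allBelow-cong : ∀ N {h h' : ℕ → Bool} → (∀ m → m < N → h m ≡ h' m) → allBelow N h ≡ allBelow N h'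
allBelow-cong zero    e = refl
allBelow-cong (suc N) e = cong₂ _∧_ (allBelow-cong N (λ m m<N → e m (ℕP.m<n⇒m<1+n m<N))) (e N ℕP.≤-refl)

allBelow⁻ : ∀ N {h : ℕ → Bool} → allBelow N h ≡ true → ∀ m → m < N → h m ≡ true
allBelow⁻ (suc N) {h} e m m<1+N with ℕP.m≤n⇒m<n∨m≡n (ℕP.≤-pred m<1+N)
... | inj₁ m<N  = allBelow⁻ N (proj₁ (∧-elim {allBelow N h} e)) m m<N
... | inj₂ refl = proj₂ (∧-elim {allBelow N h} e)

allBelow⁺ : ∀ N {h : ℕ → Bool} → (∀ m → m < N → h m ≡ true) → allBelow N h ≡ true
allBelow⁺ zero    f = refl
allBelow⁺ (suc N) f = ∧-intro (allBelow⁺ N (λ m m<N → f m (ℕP.m<n⇒m<1+n m<N))) (f N ℕP.≤-refl)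

all-allFin≡allBelow : ∀ N (h : ℕ → Bool) → all (h ∘ toℕ) (allFin N) ≡ allBelow N h
all-allFin≡allBelow N h = bool-⇔
  (λ e → allBelow⁺ N (λ m m<N → subst (λ k → h k ≡ true) (FinP.toℕ-fromℕ< m<N)
                                      (all-allFin⁻ e (fromℕ< m<N))))
  (λ e → all-allFin⁺ (λ i → allBelow⁻ N e (toℕ i) (FinP.toℕ<n i)))

-- If k columns so far are pivots, their span has q^k
-- elements, so the next column has q^b − q^k admissible values if it must
-- be a pivot and q^k if it must not.

pivotsBelow : List ℕ → ℕ → ℕ
pivotsBelow τ zero    = 0
pivotsBelow τ (suc N) = if N ∈ᵇ τ then suc (pivotsBelow τ N) else pivotsBelow τ N

columnChoices : (q b : ℕ) → Bool → ℕ → ℕ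
columnChoices q b isPivot k = if isPivot then q ^ b ∸ q ^ k else q ^ k

pivotCount : (q b : ℕ) → List ℕ → ℕ → ℕ
pivotCount q b τ zero    = 1
pivotCount q b τ (suc N) = pivotCount q b τ N * columnChoices q b (N ∈ᵇ τ) (pivotsBelow τ N)

module FieldBasics {c l : Level} {q : ℕ} (F : FiniteField c l q) where

  open FiniteField F public
    renaming ( refl to ≈-refl; sym to ≈-sym; trans to ≈-trans; reflexive to ≈-reflexive
             ; _+_ to _+ᶠ_; _*_ to _*ᶠ_; -_ to -ᶠ_; _-_ to _-ᶠ_; Σ to Σᶠ )
  open Inverse card using (to; from; to-cong; strictlyInverseʳ; strictlyInverseˡ)

  ==-true : ∀ {x y} → x == y ≡ true → x ≈ y
  ==-true {x} {y} = dec-true (x ≟ y)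

  ==-intro : ∀ {x y} → x ≈ y → x == y ≡ true
  ==-intro {x} {y} = dec-intro (x ≟ y)

  elements-enumerate : Enumerates _==_ elements
  elements-enumerate x = begin
    ∑ (χ ∘ (x ==_)) (map from (allFin q))                ≡⟨ ∑-map _ from (allFin q) ⟩
    ∑ (λ i → χ (x == from i)) (allFin q)                  ≡⟨ ∑-cong (allFin q) (cong χ ∘ ==-from) ⟩
    ∑ (λ i → χ (does (to x Fin.≟ i))) (allFin q)          ≡⟨ allFin-enumerates q (to x) ⟩
    1                                                     ∎
    where
      open ≡-Reasoning
      ==-from : ∀ i → x == from i ≡ does (to x Fin.≟ i)
      ==-from i = bool-⇔
        (λ e → dec-intro (to x Fin.≟ i) (trans (to-cong (==-true e)) (strictlyInverseˡ i)))
        (λ e → ==-intro (≈-trans (≈-sym (strictlyInverseʳ x)) (≈-reflexive (cong from (dec-true (to x Fin.≟ i) e)))))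

  any-elements : {p : Carrier → Bool} → (∀ s t → s ≈ t → p s ≡ p t) →
                 ∀ t → p t ≡ true → any p elements ≡ true
  any-elements resp = any-enumeration _==_ {elements} elements-enumerate (λ s t → resp s t ∘ ==-true)

  length-elements : length elements ≡ q
  length-elements = trans (ListP.length-map from (allFin q)) (ListP.length-tabulate (λ i → i))

  funEq : (n : ℕ) → (A → A → Bool) → (Fin n → A) → (Fin n → A) → Bool
  funEq n eqA f g = all (λ i → eqA (f i) (g i)) (allFin n)

  allFuns-enumerates : (eqA : A → A → Bool) {xs : List A} → Enumerates eqA xs →
                       ∀ n → Enumerates (funEq n eqA) (allFuns xs n)
  allFuns-enumerates eqA {xs} enum zero f = refl
  allFuns-enumerates eqA {xs} enum (suc n) f = begin
    ∑ (χ ∘ funEq (suc n) eqA f) (allFuns xs (suc n))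
      ≡⟨ ∑-concatMap _ _ xs ⟩
    ∑ (λ x → ∑ (χ ∘ funEq (suc n) eqA f) (map _ (allFuns xs n))) xs
      ≡⟨ ∑-cong xs (λ x → trans (∑-map _ _ (allFuns xs n)) (∑-cong (allFuns xs n) (λ g → split _))) ⟩
    ∑ (λ x → ∑ (λ g → χ (eqA (f Fin.zero) x) * χ (funEq n eqA (f ∘ Fin.suc) g)) (allFuns xs n)) xs
      ≡⟨ ∑-cong xs (λ x → ∑-*ˡ (χ (eqA (f Fin.zero) x)) _ (allFuns xs n)) ⟩
    ∑ (λ x → χ (eqA (f Fin.zero) x) * ∑ (χ ∘ funEq n eqA (f ∘ Fin.suc)) (allFuns xs n)) xs
      ≡⟨ ∑-cong xs (λ x → trans (cong (χ (eqA (f Fin.zero) x) *_)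
                                      (allFuns-enumerates eqA enum n (f ∘ Fin.suc)))
                                (ℕP.*-identityʳ _)) ⟩
    ∑ (χ ∘ eqA (f Fin.zero)) xs
      ≡⟨ enum (f Fin.zero) ⟩
    1 ∎
    where
      open ≡-Reasoning
      split : ∀ h → χ (funEq (suc n) eqA f h)
                    ≡ χ (eqA (f Fin.zero) (h Fin.zero)) * χ (funEq n eqA (f ∘ Fin.suc) (h ∘ Fin.suc))
      split h = trans (cong χ (trans (all-allFin (λ i → eqA (f i) (h i)))
                                     (cong (eqA (f Fin.zero) (h Fin.zero) ∧_)
                                           (sym (all-allFin (λ i → eqA (f (Fin.suc i)) (h (Fin.suc i))))))))
                      (χ-∧ (eqA (f Fin.zero) (h Fin.zero)) _)

  length-allFuns : (xs : List A) (n : ℕ) → length (allFuns xs n) ≡ length xs ^ n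
  length-allFuns xs zero    = refl
  length-allFuns xs (suc n) = begin
    length (allFuns xs (suc n))                 ≡⟨ length≡∑1 (allFuns xs (suc n)) ⟩
    ∑ (λ _ → 1) (allFuns xs (suc n))            ≡⟨ ∑-concatMap _ _ xs ⟩
    ∑ (λ x → ∑ (λ _ → 1) (map _ (allFuns xs n))) xs
      ≡⟨ ∑-cong xs (λ x → trans (∑-map (λ _ → 1) _ (allFuns xs n))
                                (trans (sym (length≡∑1 (allFuns xs n))) (length-allFuns xs n))) ⟩
    ∑ (λ x → length xs ^ n) xs                  ≡⟨ ∑-const _ xs ⟩
    length xs * length xs ^ n                   ∎
    where open ≡-Reasoning

  open import Algebra.Properties.Ring ring
    using (x[y-z]≈xy-xz; -‿involutive; -0#≈0#; -‿+-comm;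
           //-rightDividesˡ; //-rightDividesʳ)
  open import Algebra.Properties.CommutativeSemigroup +-commutativeSemigroup
    using (interchange)
  open import Relation.Binary.Reasoning.Setoid setoid
    hiding (step-≡-⟩; step-≡-⟨; step-≡-∣; step-≡; step-≡˘)

  x-y+y≈x : ∀ x y → (x -ᶠ y) +ᶠ y ≈ x
  x-y+y≈x x y = //-rightDividesˡ y x

  x+y-y≈x : ∀ x y → (x +ᶠ y) -ᶠ y ≈ x
  x+y-y≈x x y = //-rightDividesʳ y x

  x-0w≈x : ∀ x w → x -ᶠ 0# *ᶠ w ≈ x
  x-0w≈x x w = ≈-trans (+-congˡ (≈-trans (-‿cong (zeroˡ w)) -0#≈0#)) (+-identityʳ x)

  [x-a]-[x-b]≈b-a : ∀ x a b → (x -ᶠ a) -ᶠ (x -ᶠ b) ≈ b -ᶠ a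
  [x-a]-[x-b]≈b-a x a b = begin
    (x +ᶠ -ᶠ a) +ᶠ -ᶠ (x +ᶠ -ᶠ b) ≈⟨ +-congˡ (≈-trans (≈-sym (-‿+-comm x (-ᶠ b))) (+-congˡ (-‿involutive b))) ⟩
    (x +ᶠ -ᶠ a) +ᶠ (-ᶠ x +ᶠ b)    ≈⟨ interchange x (-ᶠ a) (-ᶠ x) b ⟩
    (x +ᶠ -ᶠ x) +ᶠ (-ᶠ a +ᶠ b)    ≈⟨ +-congʳ (-‿inverseʳ x) ⟩
    0# +ᶠ (-ᶠ a +ᶠ b)             ≈⟨ +-identityˡ _ ⟩
    -ᶠ a +ᶠ b                     ≈⟨ +-comm _ _ ⟩
    b -ᶠ a                        ∎

  [a-tw]+c[b-sw] : ∀ a b c t s w →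
                   (a -ᶠ t *ᶠ w) +ᶠ c *ᶠ (b -ᶠ s *ᶠ w) ≈ (a +ᶠ c *ᶠ b) -ᶠ (t +ᶠ c *ᶠ s) *ᶠ w
  [a-tw]+c[b-sw] a b c t s w = begin
    (a -ᶠ t *ᶠ w) +ᶠ c *ᶠ (b -ᶠ s *ᶠ w)
      ≈⟨ +-congˡ (x[y-z]≈xy-xz c b (s *ᶠ w)) ⟩
    (a +ᶠ -ᶠ (t *ᶠ w)) +ᶠ (c *ᶠ b +ᶠ -ᶠ (c *ᶠ (s *ᶠ w)))
      ≈⟨ interchange a _ _ _ ⟩
    (a +ᶠ c *ᶠ b) +ᶠ (-ᶠ (t *ᶠ w) +ᶠ -ᶠ (c *ᶠ (s *ᶠ w)))
      ≈⟨ +-congˡ (-‿+-comm _ _) ⟩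
    (a +ᶠ c *ᶠ b) -ᶠ (t *ᶠ w +ᶠ c *ᶠ (s *ᶠ w))
      ≈⟨ +-congˡ (-‿cong (+-congˡ (≈-sym (*-assoc c s w)))) ⟩
    (a +ᶠ c *ᶠ b) -ᶠ (t *ᶠ w +ᶠ (c *ᶠ s) *ᶠ w)
      ≈⟨ +-congˡ (-‿cong (≈-sym (distribʳ w t (c *ᶠ s)))) ⟩
    (a +ᶠ c *ᶠ b) -ᶠ (t +ᶠ c *ᶠ s) *ᶠ w ∎

  vecEq-true : ∀ {n} {u v : Vector n} → vecEq u v ≡ true → ∀ r → u r ≈ v r
  vecEq-true e r = ==-true (all-allFin⁻ e r)

  vecEq-intro : ∀ {n} {u v : Vector n} → (∀ r → u r ≈ v r) → vecEq u v ≡ true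
  vecEq-intro h = all-allFin⁺ (==-intro ∘ h)

  vecEq-cong : ∀ {n} {u u' v v' : Vector n} → (∀ r → u r ≈ u' r) → (∀ r → v r ≈ v' r) →
               vecEq u v ≡ vecEq u' v'
  vecEq-cong {u = u} {u'} {v} {v'} eu ev = bool-⇔
    (λ e → vecEq-intro (λ r → ≈-trans (≈-sym (eu r)) (≈-trans (vecEq-true {u = u} {v} e r) (ev r))))
    (λ e → vecEq-intro (λ r → ≈-trans (eu r) (≈-trans (vecEq-true {u = u'} {v'} e r) (≈-sym (ev r)))))

  vecEq-sym : ∀ {n} (u v : Vector n) → vecEq u v ≡ vecEq v u
  vecEq-sym u v = bool-⇔ (λ e → vecEq-intro (≈-sym ∘ vecEq-true {u = u} {v} e))
                         (λ e → vecEq-intro (≈-sym ∘ vecEq-true {u = v} {u} e))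

  vectors-enumerate : ∀ n → Enumerates vecEq (allFuns elements n)
  vectors-enumerate n = allFuns-enumerates _==_ elements-enumerate n

  Σ-cong : ∀ n {f g : Fin n → Carrier} → (∀ i → f i ≈ g i) → Σᶠ n f ≈ Σᶠ n g
  Σ-cong zero    e = ≈-refl
  Σ-cong (suc n) e = +-cong (e Fin.zero) (Σ-cong n (e ∘ Fin.suc))

  Σ-0 : ∀ n {f : Fin n → Carrier} → (∀ i → f i ≈ 0#) → Σᶠ n f ≈ 0#
  Σ-0 zero    e = ≈-refl
  Σ-0 (suc n) e = ≈-trans (+-cong (e Fin.zero) (Σ-0 n (e ∘ Fin.suc))) (+-identityˡ 0#)

  Σ-+ : ∀ n (f g : Fin n → Carrier) → Σᶠ n (λ i → f i +ᶠ g i) ≈ Σᶠ n f +ᶠ Σᶠ n g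
  Σ-+ zero    f g = ≈-sym (+-identityˡ 0#)
  Σ-+ (suc n) f g = ≈-trans (+-congˡ (Σ-+ n (f ∘ Fin.suc) (g ∘ Fin.suc))) (interchange _ _ _ _)

  Σ-*ˡ : ∀ n (c : Carrier) (f : Fin n → Carrier) → Σᶠ n (λ i → c *ᶠ f i) ≈ c *ᶠ Σᶠ n f
  Σ-*ˡ zero    c f = ≈-sym (zeroʳ c)
  Σ-*ˡ (suc n) c f = ≈-trans (+-congˡ (Σ-*ˡ n c (f ∘ Fin.suc))) (≈-sym (distribˡ c _ _))

  Σ-*ʳ : ∀ n (f : Fin n → Carrier) c → Σᶠ n f *ᶠ c ≈ Σᶠ n (λ i → f i *ᶠ c)
  Σ-*ʳ n f c = begin
    Σᶠ n f *ᶠ c              ≈⟨ *-comm _ c ⟩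
    c *ᶠ Σᶠ n f              ≈⟨ Σ-*ˡ n c f ⟨
    Σᶠ n (λ i → c *ᶠ f i)    ≈⟨ Σ-cong n (λ i → *-comm c (f i)) ⟩
    Σᶠ n (λ i → f i *ᶠ c)    ∎

  Σ-snoc : ∀ n (f : Fin (suc n) → Carrier) → Σᶠ (suc n) f ≈ Σᶠ n (f ∘ inject₁) +ᶠ f (fromℕ n)
  Σ-snoc zero    f = +-comm _ _
  Σ-snoc (suc n) f = ≈-trans (+-congˡ (Σ-snoc n (f ∘ Fin.suc))) (≈-sym (+-assoc _ _ _))

  Σ-swap : ∀ m n (f : Fin m → Fin n → Carrier) →
           Σᶠ m (λ i → Σᶠ n (f i)) ≈ Σᶠ n (λ j → Σᶠ m (λ i → f i j))
  Σ-swap zero    n f = ≈-sym (Σ-0 n (λ j → ≈-refl))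
  Σ-swap (suc m) n f = ≈-trans (+-congˡ (Σ-swap m n (f ∘ Fin.suc))) (≈-sym (Σ-+ n _ _))

  δ : ℕ → ℕ → Carrier
  δ a m = if a ≡ᵇ m then 1# else 0#

  δ-sym : ∀ a m → δ a m ≡ δ m a
  δ-sym zero    zero    = refl
  δ-sym zero    (suc m) = refl
  δ-sym (suc a) zero    = refl
  δ-sym (suc a) (suc m) = δ-sym a m

  δ-refl : ∀ m → δ m m ≈ 1#
  δ-refl m = ≈-reflexive (cong (λ z → if z then 1# else 0#) (≡ᵇ-refl m))

  δ-≢ : ∀ {a m} → a ≢ m → δ a m ≈ 0#
  δ-≢ {a} {m} a≢m = ≈-reflexive (cong (λ z → if z then 1# else 0#) (≡ᵇ-false a m a≢m))

  Σ-δ : ∀ n m (m<n : m < n) (f : Fin n → Carrier) → Σᶠ n (λ j → f j *ᶠ δ (toℕ j) m) ≈ f (fromℕ< m<n)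
  Σ-δ (suc n) zero    m<n       f = begin
    f Fin.zero *ᶠ 1# +ᶠ Σᶠ n (λ j → f (Fin.suc j) *ᶠ 0#) ≈⟨ +-cong (*-identityʳ _) (Σ-0 n (λ j → zeroʳ _)) ⟩
    f Fin.zero +ᶠ 0#                                     ≈⟨ +-identityʳ _ ⟩
    f Fin.zero                                           ∎
  Σ-δ (suc n) (suc m) (s≤s m<n) f = begin
    f Fin.zero *ᶠ 0# +ᶠ Σᶠ n (λ j → f (Fin.suc j) *ᶠ δ (toℕ j) m)
      ≈⟨ +-cong (zeroʳ _) (Σ-δ n m m<n (f ∘ Fin.suc)) ⟩
    0# +ᶠ f (Fin.suc (fromℕ< m<n))
      ≈⟨ +-identityˡ _ ⟩
    f (Fin.suc (fromℕ< m<n)) ∎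

module Span {c l : Level} {q : ℕ} (F : FiniteField c l q) (b : ℕ) where

  open FieldBasics F
  open import Algebra.Properties.Ring ring using (-1*x≈-x; [y-z]x≈yx-zx)
  open import Relation.Binary.Reasoning.Setoid setoid
    hiding (step-≡-⟩; step-≡-⟨; step-≡-∣; step-≡; step-≡˘)

  allVectors : List (Vector b)
  allVectors = allFuns elements b

  length-allVectors : length allVectors ≡ q ^ b
  length-allVectors = trans (length-allFuns elements b) (cong (_^ b) length-elements)

  0ᵥ : Vector b
  0ᵥ _ = 0#

  _-_·_ : Vector b → Carrier → Vector b → Vector b
  (v - t · w) r = v r -ᶠ t *ᶠ w r

  spanned : List (Vector b) → Vector b → Bool
  spanned []       v = vecEq v 0ᵥ
  spanned (w ∷ ws) v = any (λ t → spanned ws (v - t · w)) elements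

  rank : List (Vector b) → ℕ
  rank []       = 0
  rank (w ∷ ws) = if spanned ws w then rank ws else suc (rank ws)

  spanned-cong : ∀ ws {v v' : Vector b} → (∀ r → v r ≈ v' r) → spanned ws v ≡ spanned ws v'
  spanned-cong []       e = vecEq-cong e (λ _ → ≈-refl)
  spanned-cong (w ∷ ws) e = bool-⇔ (transfer e) (transfer (≈-sym ∘ e))
    where
      transfer : ∀ {x y : Vector b} → (∀ r → x r ≈ y r) →
                 spanned (w ∷ ws) x ≡ true → spanned (w ∷ ws) y ≡ true
      transfer {x} {y} x≈y h with any-witness {p = λ t → spanned ws (x - t · w)} {elements} h
      ... | t , ht = span-intro' t (trans (sym (spanned-cong ws (λ r → +-congʳ (x≈y r)))) ht)
        where
          span-intro' : ∀ t → spanned ws (y - t · w) ≡ true → spanned (w ∷ ws) y ≡ true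
          span-intro' = any-elements (λ s s' s≈s' → spanned-cong ws (λ r → +-congˡ (-‿cong (*-congʳ s≈s'))))

  span-intro : ∀ w ws v t → spanned ws (v - t · w) ≡ true → spanned (w ∷ ws) v ≡ true
  span-intro w ws v = any-elements (λ s s' s≈s' → spanned-cong ws (λ r → +-congˡ (-‿cong (*-congʳ s≈s'))))

  span-elim : ∀ w ws v → spanned (w ∷ ws) v ≡ true → ∃ λ t → spanned ws (v - t · w) ≡ true
  span-elim w ws v = any-witness {p = λ t → spanned ws (v - t · w)} {elements}

  span-zero : ∀ ws (v : Vector b) → (∀ r → v r ≈ 0#) → spanned ws v ≡ true
  span-zero []       v v≈0 = vecEq-intro v≈0
  span-zero (w ∷ ws) v v≈0 =
    span-intro w ws v 0# (span-zero ws _ (λ r → ≈-trans (x-0w≈x (v r) (w r)) (v≈0 r)))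

  span-lin : ∀ ws (x y : Vector b) c → spanned ws x ≡ true → spanned ws y ≡ true →
             spanned ws (λ r → x r +ᶠ c *ᶠ y r) ≡ true
  span-lin []       x y c hx hy = vecEq-intro (λ r → begin
    x r +ᶠ c *ᶠ y r ≈⟨ +-cong (vecEq-true {u = x} hx r) (*-congˡ (vecEq-true {u = y} hy r)) ⟩
    0# +ᶠ c *ᶠ 0#   ≈⟨ +-identityˡ _ ⟩
    c *ᶠ 0#         ≈⟨ zeroʳ c ⟩
    0#              ∎)
  span-lin (w ∷ ws) x y c hx hy with span-elim w ws x hx | span-elim w ws y hy
  ... | t , ht | s , hs = span-intro w ws _ (t +ᶠ c *ᶠ s)
    (trans (sym (spanned-cong ws (λ r → [a-tw]+c[b-sw] (x r) (y r) c t s (w r))))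
           (span-lin ws _ _ c ht hs))

  span-redundant : ∀ w ws → spanned ws w ≡ true → ∀ v → spanned (w ∷ ws) v ≡ spanned ws v
  span-redundant w ws w∈ v = bool-⇔
    (λ h → let (t , ht) = span-elim w ws v h in
           trans (sym (spanned-cong ws (λ r → x-y+y≈x (v r) (t *ᶠ w r)))) (span-lin ws _ w t ht w∈))
    (λ h → span-intro w ws v 0# (trans (spanned-cong ws (λ r → x-0w≈x (v r) (w r))) h))

  -- if w is not in the span of ws, the coefficient of w in a combination
  -- of w ∷ ws is unique: otherwise (t' − t)·w would lie in the span of ws
  coefficient-unique : ∀ w ws → spanned ws w ≡ false → ∀ (v : Vector b) t t' →
                       spanned ws (v - t · w) ≡ true → spanned ws (v - t' · w) ≡ true → t == t' ≡ true
  coefficient-unique w ws w∉ v t t' ht ht' with t ≟ t'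
  ... | yes _   = refl
  ... | no t≉t' = ⊥-elim (true≢false (trans (sym w∈) w∉))
    where
      d = t' -ᶠ t
      d≉0 : ¬ (d ≈ 0#)
      d≉0 d≈0 = t≉t' (≈-sym (≈-trans (≈-sym (x-y+y≈x t' t)) (≈-trans (+-congʳ d≈0) (+-identityˡ t))))
      d⁻¹ = proj₁ (inverse d d≉0)
      dw∈ : spanned ws (λ r → d *ᶠ w r) ≡ true
      dw∈ = trans (sym (spanned-cong ws (λ r → begin
          (v r -ᶠ t *ᶠ w r) +ᶠ (-ᶠ 1#) *ᶠ (v r -ᶠ t' *ᶠ w r) ≈⟨ +-congˡ (-1*x≈-x _) ⟩
          (v r -ᶠ t *ᶠ w r) -ᶠ (v r -ᶠ t' *ᶠ w r)            ≈⟨ [x-a]-[x-b]≈b-a (v r) _ _ ⟩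
          t' *ᶠ w r -ᶠ t *ᶠ w r                              ≈⟨ [y-z]x≈yx-zx (w r) t' t ⟨
          d *ᶠ w r                                           ∎)))
        (span-lin ws _ _ (-ᶠ 1#) ht ht')
      w∈ : spanned ws w ≡ true
      w∈ = trans (sym (spanned-cong ws (λ r → begin
          0# +ᶠ d⁻¹ *ᶠ (d *ᶠ w r) ≈⟨ +-identityˡ _ ⟩
          d⁻¹ *ᶠ (d *ᶠ w r)       ≈⟨ *-assoc d⁻¹ d (w r) ⟨
          (d⁻¹ *ᶠ d) *ᶠ w r       ≈⟨ *-congʳ (≈-trans (*-comm d⁻¹ d) (proj₂ (inverse d d≉0))) ⟩
          1# *ᶠ w r               ≈⟨ *-identityˡ (w r) ⟩
          w r                     ∎)))
        (span-lin ws 0ᵥ _ d⁻¹ (span-zero ws 0ᵥ (λ _ → ≈-refl)) dw∈)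

  -- translating every vector by a fixed d preserves the number of vectors
  -- satisfying a test, since translation permutes allVectors
  ∑-translate : (d : Vector b) {p : Vector b → Bool} → Respects vecEq p →
                ∑ (λ v → χ (p (λ r → v r -ᶠ d r))) allVectors ≡ ∑ (χ ∘ p) allVectors
  ∑-translate d {p} resp = trans (sym (∑-map (χ ∘ p) translate allVectors))
    (count-enumeration-invariant vecEq vecEq-sym resp (map translate allVectors) allVectors translates-enumerate (vectors-enumerate b))
    where
      translate : Vector b → Vector b
      translate v r = v r -ᶠ d r
      translates-enumerate : Enumerates vecEq (map translate allVectors)
      translates-enumerate x = begin-≡
        ∑ (χ ∘ vecEq x) (map translate allVectors)                    ≡⟨ ∑-map _ translate allVectors ⟩
        ∑ (λ y → χ (vecEq x (translate y))) allVectors                ≡⟨ ∑-cong allVectors (cong χ ∘ shift) ⟩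
        ∑ (λ y → χ (vecEq (λ r → x r +ᶠ d r) y)) allVectors           ≡⟨ vectors-enumerate b _ ⟩
        1                                                             ∎-≡
        where
          open ≡-Reasoning renaming (begin_ to begin-≡_; _∎ to _∎-≡)
          shift : ∀ y → vecEq x (translate y) ≡ vecEq (λ r → x r +ᶠ d r) y
          shift y = bool-⇔
            (λ h → vecEq-intro (λ r → ≈-trans (+-congʳ (vecEq-true {u = x} h r)) (x-y+y≈x (y r) (d r))))
            (λ h → vecEq-intro (λ r → ≈-trans (≈-sym (x+y-y≈x (x r) (d r)))
                                              (+-congʳ (vecEq-true {u = λ r → x r +ᶠ d r} h r))))

  span-count : ∀ ws → ∑ (χ ∘ spanned ws) allVectors ≡ q ^ rank ws
  span-count []       = trans (∑-cong allVectors (λ v → cong χ (vecEq-sym v 0ᵥ))) (vectors-enumerate b 0ᵥ)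
  span-count (w ∷ ws) with spanned ws w in w∈?
  ... | true  = trans (∑-cong allVectors (cong χ ∘ span-redundant w ws w∈?)) (span-count ws)
  ... | false = begin-≡
    ∑ (λ v → χ (any (λ t → spanned ws (v - t · w)) elements)) allVectors
      ≡⟨ ∑-cong allVectors (λ v → χ-any-unique _==_ (λ x → ==-intro ≈-refl) {elements} elements-enumerate
                                                (coefficient-unique w ws w∈? v)) ⟩
    ∑ (λ v → ∑ (λ t → χ (spanned ws (v - t · w))) elements) allVectors
      ≡⟨ ∑-swap _ allVectors elements ⟩
    ∑ (λ t → ∑ (λ v → χ (spanned ws (v - t · w))) allVectors) elements
      ≡⟨ ∑-cong elements (λ t → ∑-translate (λ r → t *ᶠ w r) (λ x y → spanned-cong ws ∘ vecEq-true {u = x} {y})) ⟩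
    ∑ (λ t → ∑ (χ ∘ spanned ws) allVectors) elements
      ≡⟨ ∑-cong elements (λ t → span-count ws) ⟩
    ∑ (λ t → q ^ rank ws) elements
      ≡⟨ ∑-const _ elements ⟩
    length elements * q ^ rank ws
      ≡⟨ cong (_* q ^ rank ws) length-elements ⟩
    q * q ^ rank ws ∎-≡
    where open ≡-Reasoning renaming (begin_ to begin-≡_; _∎ to _∎-≡)

-- Enumerating the streams of length N
-- by appending one column at a time, the number of them with pivot set τ
-- satisfies the recurrence defining pivotCount: once the first N columns
-- match τ, their span has q ^ pivotsBelow τ N elements, and column N must
-- lie outside it exactly when N ∈ τ.

module PivotRecurrence {c l : Level} {q : ℕ} (F : FiniteField c l q) (b : ℕ) where

  open FieldBasics F
  open Span F b

  Stream : Set c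
  Stream = ℕ → Vector b

  columnsBefore : Stream → ℕ → List (Vector b)
  columnsBefore u zero    = []
  columnsBefore u (suc n) = u n ∷ columnsBefore u n

  pivotAt : Stream → ℕ → Bool
  pivotAt u n = not (spanned (columnsBefore u n) (u n))

  pivotsMatch : List ℕ → ℕ → Stream → Bool
  pivotsMatch τ N u = allBelow N (λ m → pivotAt u m ⇔ᵇ (m ∈ᵇ τ))

  columnsBefore-prefix : ∀ n {u u' : Stream} → (∀ m → m < n → u m ≡ u' m) →
                         columnsBefore u n ≡ columnsBefore u' n
  columnsBefore-prefix zero    e = refl
  columnsBefore-prefix (suc n) e =
    cong₂ _∷_ (e n ℕP.≤-refl) (columnsBefore-prefix n (λ m m<n → e m (ℕP.m<n⇒m<1+n m<n)))

  pivotsMatch-prefix : ∀ τ N {u u' : Stream} → (∀ m → m < N → u m ≡ u' m) →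
                       pivotsMatch τ N u ≡ pivotsMatch τ N u'
  pivotsMatch-prefix τ N e = allBelow-cong N (λ m m<N →
    cong (λ x → not x ⇔ᵇ (m ∈ᵇ τ))
         (cong₂ spanned (columnsBefore-prefix m (λ k k<m → e k (ℕP.<-trans k<m m<N))) (e m m<N)))

  rank-pivotsMatch : ∀ τ N u → pivotsMatch τ N u ≡ true → rank (columnsBefore u N) ≡ pivotsBelow τ N
  rank-pivotsMatch τ zero    u _ = refl
  rank-pivotsMatch τ (suc N) u e with ∧-elim {pivotsMatch τ N u} e
  ... | matchN , _ with spanned (columnsBefore u N) (u N) | N ∈ᵇ τ
  ... | true  | false = rank-pivotsMatch τ N u matchN
  ... | false | true  = cong suc (rank-pivotsMatch τ N u matchN)

  setColumn : Stream → ℕ → Vector b → Stream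
  setColumn u N x n = if n ≡ᵇ N then x else u n

  setColumn-other : ∀ u N x m → m < N → setColumn u N x m ≡ u m
  setColumn-other u N x m m<N rewrite ≡ᵇ-false m N (ℕP.<⇒≢ m<N) = refl

  setColumn-same : ∀ u N x → setColumn u N x N ≡ x
  setColumn-same u N x rewrite ≡ᵇ-refl N = refl

  streams : ℕ → List Stream
  streams zero    = (λ _ → 0ᵥ) ∷ []
  streams (suc N) = concatMap (λ u → map (setColumn u N) allVectors) (streams N)

  columnChoices-count : ∀ ws isPivot →
    ∑ (λ x → χ (not (spanned ws x) ⇔ᵇ isPivot)) allVectors ≡ columnChoices q b isPivot (rank ws)
  columnChoices-count ws true  = begin
    ∑ (λ x → χ (not (spanned ws x) ⇔ᵇ true)) allVectors
      ≡⟨ ∑-cong allVectors (λ x → cong χ (⇔ᵇ-true (not (spanned ws x)))) ⟩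
    ∑ (χ ∘ not ∘ spanned ws) allVectors
      ≡⟨ ℕP.m+n∸n≡m _ (∑ (χ ∘ spanned ws) allVectors) ⟨
    ∑ (χ ∘ not ∘ spanned ws) allVectors + ∑ (χ ∘ spanned ws) allVectors ∸ ∑ (χ ∘ spanned ws) allVectors
      ≡⟨ cong₂ _∸_ (trans (∑χ-not+∑χ (spanned ws) allVectors) length-allVectors) (span-count ws) ⟩
    q ^ b ∸ q ^ rank ws ∎
    where open ≡-Reasoning
  columnChoices-count ws false =
    trans (∑-cong allVectors (λ x → cong χ (⇔ᵇ-false (spanned ws x)))) (span-count ws)

  pivot-recurrence : ∀ τ N → ∑ (χ ∘ pivotsMatch τ N) (streams N) ≡ pivotCount q b τ N
  pivot-recurrence τ zero    = refl
  pivot-recurrence τ (suc N) = begin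
    ∑ (χ ∘ pivotsMatch τ (suc N)) (streams (suc N))
      ≡⟨ ∑-concatMap _ _ (streams N) ⟩
    ∑ (λ u → ∑ (χ ∘ pivotsMatch τ (suc N)) (map (setColumn u N) allVectors)) (streams N)
      ≡⟨ ∑-cong (streams N) (λ u → trans (∑-map _ (setColumn u N) allVectors)
                                         (∑-cong allVectors (split u))) ⟩
    ∑ (λ u → ∑ (λ x → χ (pivotsMatch τ N u) * χ (newColumnOK u x)) allVectors) (streams N)
      ≡⟨ ∑-cong (streams N) (λ u → ∑-*ˡ (χ (pivotsMatch τ N u)) _ allVectors) ⟩
    ∑ (λ u → χ (pivotsMatch τ N u) * ∑ (χ ∘ newColumnOK u) allVectors) (streams N)
      ≡⟨ ∑-cong (streams N) choices ⟩
    ∑ (λ u → choicesN * χ (pivotsMatch τ N u)) (streams N)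
      ≡⟨ ∑-*ˡ choicesN _ (streams N) ⟩
    choicesN * ∑ (χ ∘ pivotsMatch τ N) (streams N)
      ≡⟨ cong (choicesN *_) (pivot-recurrence τ N) ⟩
    choicesN * pivotCount q b τ N
      ≡⟨ ℕP.*-comm choicesN _ ⟩
    pivotCount q b τ (suc N) ∎
    where
      open ≡-Reasoning
      choicesN = columnChoices q b (N ∈ᵇ τ) (pivotsBelow τ N)
      newColumnOK : Stream → Vector b → Bool
      newColumnOK u x = not (spanned (columnsBefore u N) x) ⇔ᵇ (N ∈ᵇ τ)
      split : ∀ u x → χ (pivotsMatch τ (suc N) (setColumn u N x))
                      ≡ χ (pivotsMatch τ N u) * χ (newColumnOK u x)
      split u x = trans (χ-∧ (pivotsMatch τ N (setColumn u N x)) _)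
        (cong₂ (λ m y → χ m * χ (not y ⇔ᵇ (N ∈ᵇ τ)))
               (pivotsMatch-prefix τ N (setColumn-other u N x))
               (cong₂ spanned (columnsBefore-prefix N (setColumn-other u N x)) (setColumn-same u N x)))
      choices : ∀ u → χ (pivotsMatch τ N u) * ∑ (χ ∘ newColumnOK u) allVectors
                      ≡ choicesN * χ (pivotsMatch τ N u)
      choices u with pivotsMatch τ N u in match
      ... | false = sym (ℕP.*-zeroʳ choicesN)
      ... | true  = trans (ℕP.+-identityʳ _)
          (trans (columnChoices-count (columnsBefore u N) (N ∈ᵇ τ))
          (trans (cong (columnChoices q b (N ∈ᵇ τ)) (rank-pivotsMatch τ N u match))
                 (sym (ℕP.*-identityʳ _))))

snoc : ∀ {k} → (Fin k → A) → A → Fin (suc k) → A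
snoc {k = zero}  f t _           = t
snoc {k = suc k} f t Fin.zero    = f Fin.zero
snoc {k = suc k} f t (Fin.suc i) = snoc (f ∘ Fin.suc) t i

snoc-inject₁ : ∀ {k} (f : Fin k → A) t (i : Fin k) → snoc f t (inject₁ i) ≡ f i
snoc-inject₁ {k = suc k} f t Fin.zero    = refl
snoc-inject₁ {k = suc k} f t (Fin.suc i) = snoc-inject₁ (f ∘ Fin.suc) t i

snoc-last : ∀ {k} (f : Fin k → A) t → snoc f t (fromℕ k) ≡ t
snoc-last {k = zero}  f t = refl
snoc-last {k = suc k} f t = snoc-last (f ∘ Fin.suc) t

-- The pivot test of Defs (an exhaustive
-- search for coefficients) agrees with `pivotAt` on the column stream, and
-- listing the streams of length N column by column enumerates all b × N
-- matrices, so countPivotSet is the count computed by pivot-recurrence.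

module MatrixBridge {c l : Level} {q : ℕ} (F : FiniteField c l q) (b : ℕ) where

  open FieldBasics F
  open Span F b
  open PivotRecurrence F b
  open import Relation.Binary.Reasoning.Setoid setoid
    hiding (step-≡-⟩; step-≡-⟨; step-≡-∣; step-≡; step-≡˘)

  IsCombination : ∀ k → (Fin k → Vector b) → Vector b → (Fin k → Carrier) → Set l
  IsCombination k w v a = ∀ r → Σᶠ k (λ j → a j *ᶠ w j r) ≈ v r

  inSpan⇒ : ∀ k w v → inSpan k w v ≡ true → ∃ (IsCombination k w v)
  inSpan⇒ k w v e with any-witness {p = λ a → vecEq (λ r → Σᶠ k (λ j → a j *ᶠ w j r)) v}
                                   {allFuns elements k} e
  ... | a , h = a , vecEq-true {u = λ r → Σᶠ k (λ j → a j *ᶠ w j r)} h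

  inSpan⇐ : ∀ k w v a → IsCombination k w v a → inSpan k w v ≡ true
  inSpan⇐ k w v a h = any-enumeration vecEq {allFuns elements k} (vectors-enumerate k)
    (λ x y x≈y → vecEq-cong {u = λ r → Σᶠ k (λ j → x j *ᶠ w j r)} {λ r → Σᶠ k (λ j → y j *ᶠ w j r)} {v} {v}
                   (λ r → Σ-cong k (λ j → *-congʳ (vecEq-true {u = x} {y} x≈y j))) (λ _ → ≈-refl))
    a (vecEq-intro h)

  Lists : ∀ k → (Fin k → Vector b) → Stream → Set l
  Lists k w u = ∀ j r → w j r ≈ u (toℕ j) r

  Lists-init : ∀ {k w u} → Lists (suc k) w u → Lists k (w ∘ inject₁) u
  Lists-init {u = u} H j r = ≈-trans (H (inject₁ j) r) (≈-reflexive (cong (λ n → u n r) (FinP.toℕ-inject₁ j)))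

  Lists-last : ∀ {k w u} → Lists (suc k) w u → ∀ r → w (fromℕ k) r ≈ u k r
  Lists-last {k} {u = u} H r = ≈-trans (H (fromℕ k) r) (≈-reflexive (cong (λ n → u n r) (FinP.toℕ-fromℕ k)))

  combination⇒spanned : ∀ k w u → Lists k w u → ∀ v a → IsCombination k w v a →
                        spanned (columnsBefore u k) v ≡ true
  combination⇒spanned zero    w u H v a h = vecEq-intro (≈-sym ∘ h)
  combination⇒spanned (suc k) w u H v a h = span-intro (u k) (columnsBefore u k) v t
    (combination⇒spanned k (w ∘ inject₁) u (Lists-init {u = u} H) _ (a ∘ inject₁) (λ r → begin
      Σᶠ k (λ j → a (inject₁ j) *ᶠ w (inject₁ j) r)
        ≈⟨ x+y-y≈x _ _ ⟨
      (Σᶠ k (λ j → a (inject₁ j) *ᶠ w (inject₁ j) r) +ᶠ t *ᶠ w (fromℕ k) r) -ᶠ t *ᶠ w (fromℕ k) r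
        ≈⟨ +-cong (≈-trans (≈-sym (Σ-snoc k (λ j → a j *ᶠ w j r))) (h r))
                  (-‿cong (*-congˡ (Lists-last {u = u} H r))) ⟩
      v r -ᶠ t *ᶠ u k r ∎))
    where t = a (fromℕ k)

  spanned⇒combination : ∀ k w u → Lists k w u → ∀ v →
                        spanned (columnsBefore u k) v ≡ true → ∃ (IsCombination k w v)
  spanned⇒combination zero    w u H v e = (λ ()) , (λ r → ≈-sym (vecEq-true {u = v} e r))
  spanned⇒combination (suc k) w u H v e with span-elim (u k) (columnsBefore u k) v e
  ... | t , ht with spanned⇒combination k (w ∘ inject₁) u (Lists-init {u = u} H) _ ht
  ...   | a , ha = snoc a t , λ r → begin
    Σᶠ (suc k) (λ j → snoc a t j *ᶠ w j r)
      ≈⟨ Σ-snoc k (λ j → snoc a t j *ᶠ w j r) ⟩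
    Σᶠ k (λ j → snoc a t (inject₁ j) *ᶠ w (inject₁ j) r) +ᶠ snoc a t (fromℕ k) *ᶠ w (fromℕ k) r
      ≈⟨ +-cong (Σ-cong k (λ j → *-congʳ (≈-reflexive (snoc-inject₁ a t j))))
                (*-cong (≈-reflexive (snoc-last a t)) (Lists-last {u = u} H r)) ⟩
    Σᶠ k (λ j → a j *ᶠ w (inject₁ j) r) +ᶠ t *ᶠ u k r
      ≈⟨ +-congʳ (ha r) ⟩
    (v r -ᶠ t *ᶠ u k r) +ᶠ t *ᶠ u k r
      ≈⟨ x-y+y≈x _ _ ⟩
    v r ∎

  inSpan≡spanned : ∀ k w u → Lists k w u → ∀ v → inSpan k w v ≡ spanned (columnsBefore u k) v
  inSpan≡spanned k w u H v = bool-⇔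
    (λ e → let (a , h) = inSpan⇒ k w v e in combination⇒spanned k w u H v a h)
    (λ e → let (a , h) = spanned⇒combination k w u H v e in inSpan⇐ k w v a h)

  toMatrix : ∀ {N} → Stream → Matrix b N
  toMatrix u r i = u (toℕ i) r

  isPivot≡pivotAt : ∀ {N} (M : Matrix b N) (u : Stream) → (∀ r j → M r j ≈ u (toℕ j) r) →
                    ∀ i → isPivot M i ≡ pivotAt u (toℕ i)
  isPivot≡pivotAt M u H i = cong not (trans
    (inSpan≡spanned (toℕ i) (λ j → column M (Fin.inject j)) u
       (λ j r → ≈-trans (H r (Fin.inject j)) (≈-reflexive (cong (λ n → u n r) (FinP.toℕ-inject j))))
       (column M i))
    (spanned-cong (columnsBefore u (toℕ i)) (λ r → H r i)))

  isPivot-cong : ∀ {N} {M M' : Matrix b N} → (∀ r j → M r j ≈ M' r j) → ∀ i → isPivot M i ≡ isPivot M' i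
  isPivot-cong M≈M' i = cong not (cong or (ListP.map-cong (λ a →
    vecEq-cong (λ r → Σ-cong (toℕ i) (λ j → *-congˡ (M≈M' r (Fin.inject j)))) (λ r → M≈M' r i))
    (allFuns elements (toℕ i))))

  matrixEq : ∀ {N} → Matrix b N → Matrix b N → Bool
  matrixEq M M' = funEq b vecEq M M'

  matrixEq-true : ∀ {N} {M M' : Matrix b N} → matrixEq M M' ≡ true → ∀ r i → M r i ≈ M' r i
  matrixEq-true {M = M} {M'} e r = vecEq-true {u = M r} {M' r} (all-allFin⁻ e r)

  matrixEq-intro : ∀ {N} {M M' : Matrix b N} → (∀ r i → M r i ≈ M' r i) → matrixEq M M' ≡ true
  matrixEq-intro {M = M} {M'} h = all-allFin⁺ (λ r → vecEq-intro {u = M r} {M' r} (h r))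

  matrixEq-sym : ∀ {N} (M M' : Matrix b N) → matrixEq M M' ≡ matrixEq M' M
  matrixEq-sym M M' = bool-⇔
    (λ e → matrixEq-intro {M = M'} {M} (λ r i → ≈-sym (matrixEq-true {M = M} {M'} e r i)))
    (λ e → matrixEq-intro {M = M} {M'} (λ r i → ≈-sym (matrixEq-true {M = M'} {M} e r i)))

  matrices-enumerate : ∀ N → Enumerates matrixEq (allMatrices b N)
  matrices-enumerate N = allFuns-enumerates vecEq (vectors-enumerate N) b

  toMatrix-setColumn : ∀ N (M : Matrix b (suc N)) u x →
    matrixEq M (toMatrix (setColumn u N x))
    ≡ matrixEq {N} (λ r j → M r (inject₁ j)) (toMatrix u) ∧ vecEq (λ r → M r (fromℕ N)) x
  toMatrix-setColumn N M u x = bool-⇔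
    (λ e → let E = matrixEq-true {M = M} {toMatrix (setColumn u N x)} e in ∧-intro
       (matrixEq-intro {M = λ r j → M r (inject₁ j)} {toMatrix u} (λ r j → ≈-trans (E r (inject₁ j))
          (≈-reflexive (cong (λ z → z r) (trans (cong (setColumn u N x) (FinP.toℕ-inject₁ j))
                                                (setColumn-other u N x (toℕ j) (FinP.toℕ<n j)))))))
       (vecEq-intro (λ r → ≈-trans (E r (fromℕ N))
          (≈-reflexive (cong (λ z → z r) (trans (cong (setColumn u N x) (FinP.toℕ-fromℕ N))
                                                (setColumn-same u N x)))))))
    (λ e → let (init≈ , last≈) = ∧-elim {matrixEq {N} (λ r j → M r (inject₁ j)) (toMatrix u)} e in
       matrixEq-intro {M = M} {toMatrix (setColumn u N x)}
         (entries (matrixEq-true {M = λ r j → M r (inject₁ j)} {toMatrix u} init≈)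
                  (vecEq-true {u = λ r → M r (fromℕ N)} last≈)))
    where
      entries : (∀ r j → M r (inject₁ j) ≈ u (toℕ j) r) → (∀ r → M r (fromℕ N) ≈ x r) →
                ∀ r i → M r i ≈ setColumn u N x (toℕ i) r
      entries init≈ last≈ r i with N ℕ.≟ toℕ i
      ... | yes N≡i = ≈-trans (≈-reflexive (cong (M r) i≡N)) (≈-trans (last≈ r)
                        (≈-reflexive (cong (λ z → z r) (sym (trans (cong (setColumn u N x) (sym N≡i))
                                                                   (setColumn-same u N x))))))
        where i≡N = FinP.toℕ-injective (trans (sym N≡i) (sym (FinP.toℕ-fromℕ N)))
      ... | no N≢i  = ≈-trans (≈-reflexive (cong (M r) (sym (FinP.inject₁-lower₁ i N≢i))))
                        (≈-trans (init≈ r j) (≈-reflexive (cong (λ z → z r)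
                          (trans (cong u j≡i) (sym (setColumn-other u N x (toℕ i) i<N))))))
        where
          j = Fin.lower₁ i N≢i
          j≡i = FinP.toℕ-lower₁ i N≢i
          i<N = subst (_< N) j≡i (FinP.toℕ<n j)

  streams-enumerate : ∀ N → Enumerates matrixEq (map toMatrix (streams N))
  streams-enumerate zero    M = cong (λ e → χ e + 0) (matrixEq-intro {M = M} {toMatrix (λ _ → 0ᵥ)} (λ r ()))
  streams-enumerate (suc N) M = begin-≡
    ∑ (χ ∘ matrixEq M) (map toMatrix (streams (suc N)))
      ≡⟨ ∑-map _ toMatrix (streams (suc N)) ⟩
    ∑ (χ ∘ matrixEq M ∘ toMatrix) (streams (suc N))
      ≡⟨ ∑-concatMap _ _ (streams N) ⟩
    ∑ (λ u → ∑ (χ ∘ matrixEq M ∘ toMatrix) (map (setColumn u N) allVectors)) (streams N)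
      ≡⟨ ∑-cong (streams N) (λ u → trans (∑-map _ (setColumn u N) allVectors)
                                         (∑-cong allVectors (split u))) ⟩
    ∑ (λ u → ∑ (λ x → χ (matrixEq M₀ (toMatrix u)) * χ (vecEq lastColumn x)) allVectors) (streams N)
      ≡⟨ ∑-cong (streams N) (λ u → trans (∑-*ˡ (χ (matrixEq M₀ (toMatrix u))) _ allVectors)
                                         (trans (cong (χ (matrixEq M₀ (toMatrix u)) *_)
                                                      (vectors-enumerate b lastColumn))
                                                (ℕP.*-identityʳ _))) ⟩
    ∑ (χ ∘ matrixEq M₀ ∘ toMatrix) (streams N)
      ≡⟨ ∑-map _ toMatrix (streams N) ⟨
    ∑ (χ ∘ matrixEq M₀) (map toMatrix (streams N))
      ≡⟨ streams-enumerate N M₀ ⟩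
    1 ∎-≡
    where
      open ≡-Reasoning renaming (begin_ to begin-≡_; _∎ to _∎-≡)
      M₀ : Matrix b N
      M₀ r j = M r (inject₁ j)
      lastColumn : Vector b
      lastColumn r = M r (fromℕ N)
      split : ∀ u x → χ (matrixEq M (toMatrix (setColumn u N x)))
                      ≡ χ (matrixEq M₀ (toMatrix u)) * χ (vecEq lastColumn x)
      split u x = trans (cong χ (toMatrix-setColumn N M u x)) (χ-∧ (matrixEq M₀ (toMatrix u)) _)

  hasPivotSet : ∀ {N} → List ℕ → Matrix b N → Bool
  hasPivotSet {N} τ M = all (λ i → isPivot M i ⇔ᵇ (toℕ i ∈ᵇ τ)) (allFin N)

  hasPivotSet-toMatrix : ∀ N τ u → hasPivotSet τ (toMatrix {N} u) ≡ pivotsMatch τ N u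
  hasPivotSet-toMatrix N τ u = trans
    (all-allFin-cong {N} (λ i → cong (_⇔ᵇ (toℕ i ∈ᵇ τ)) (isPivot≡pivotAt (toMatrix u) u (λ r j → ≈-refl) i)))
    (all-allFin≡allBelow N (λ m → pivotAt u m ⇔ᵇ (m ∈ᵇ τ)))

  countPivotSet≡pivotCount : ∀ N τ → countPivotSet b N τ ≡ pivotCount q b τ N
  countPivotSet≡pivotCount N τ = begin-≡
    countPivotSet b N τ
      ≡⟨ count≡∑χ (hasPivotSet τ) (allMatrices b N) ⟩
    ∑ (χ ∘ hasPivotSet τ) (allMatrices b N)
      ≡⟨ count-enumeration-invariant matrixEq matrixEq-sym respects (allMatrices b N)
           (map toMatrix (streams N)) (matrices-enumerate N) (streams-enumerate N) ⟩
    ∑ (χ ∘ hasPivotSet τ) (map toMatrix (streams N))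
      ≡⟨ ∑-map (χ ∘ hasPivotSet τ) (toMatrix {N}) (streams N) ⟩
    ∑ (χ ∘ hasPivotSet τ ∘ toMatrix {N}) (streams N)
      ≡⟨ ∑-cong (streams N) (λ u → cong χ (hasPivotSet-toMatrix N τ u)) ⟩
    ∑ (χ ∘ pivotsMatch τ N) (streams N)
      ≡⟨ pivot-recurrence τ N ⟩
    pivotCount q b τ N ∎-≡
    where
      open ≡-Reasoning renaming (begin_ to begin-≡_; _∎ to _∎-≡)
      respects : Respects matrixEq (hasPivotSet τ)
      respects M M' e = all-allFin-cong {N} (λ i →
        cong (_⇔ᵇ (toℕ i ∈ᵇ τ)) (isPivot-cong (matrixEq-true {M = M} {M'} e) i))

-- A square matrix is invertible iff all its columns
-- are pivots.  If A has a left inverse, A·y = 0 forces y = 0, so no column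
-- is a combination of the earlier ones.  Conversely, if all b columns are
-- pivots their span has q ^ b elements, i.e. is everything, so A·x = v is
-- solvable for every v; this gives a right inverse X, which (having the
-- left inverse A) is itself injective, hence has a right inverse Y = A.

module GeneralLinear {c l : Level} {q : ℕ} (F : FiniteField c l q) (b : ℕ) where

  open FieldBasics F
  open Span F b
  open PivotRecurrence F b
  open MatrixBridge F b
  open import Algebra.Properties.Ring ring using (-1*x≈-x; -‿involutive; -0#≈0#)
  open import Relation.Binary.Reasoning.Setoid setoid
    hiding (step-≡-⟩; step-≡-⟨; step-≡-∣; step-≡; step-≡˘)

  -- matrix times vector; note (A ⊗ B) r s = (A ·ᵥ column B s) r
  _·ᵥ_ : Matrix b b → Vector b → Vector b
  (A ·ᵥ x) r = Σᶠ b (λ j → A r j *ᶠ x j)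

  ·ᵥ-cong : ∀ {A A' x x'} → (∀ r s → A r s ≈ A' r s) → (∀ j → x j ≈ x' j) → ∀ r → (A ·ᵥ x) r ≈ (A' ·ᵥ x') r
  ·ᵥ-cong A≈A' x≈x' r = Σ-cong b (λ j → *-cong (A≈A' r j) (x≈x' j))

  ·ᵥ-assoc : ∀ A B x r → ((A ⊗ B) ·ᵥ x) r ≈ (A ·ᵥ (B ·ᵥ x)) r
  ·ᵥ-assoc A B x r = begin
    Σᶠ b (λ j → Σᶠ b (λ k → A r k *ᶠ B k j) *ᶠ x j)   ≈⟨ Σ-cong b (λ j → Σ-*ʳ b _ (x j)) ⟩
    Σᶠ b (λ j → Σᶠ b (λ k → (A r k *ᶠ B k j) *ᶠ x j)) ≈⟨ Σ-cong b (λ j → Σ-cong b (λ k → *-assoc _ _ _)) ⟩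
    Σᶠ b (λ j → Σᶠ b (λ k → A r k *ᶠ (B k j *ᶠ x j))) ≈⟨ Σ-swap b b _ ⟩
    Σᶠ b (λ k → Σᶠ b (λ j → A r k *ᶠ (B k j *ᶠ x j))) ≈⟨ Σ-cong b (λ k → Σ-*ˡ b (A r k) _) ⟩
    Σᶠ b (λ k → A r k *ᶠ (B ·ᵥ x) k)                  ∎

  ·ᵥ-zero : ∀ A (x : Vector b) → (∀ j → x j ≈ 0#) → ∀ r → (A ·ᵥ x) r ≈ 0#
  ·ᵥ-zero A x x≈0 r = Σ-0 b (λ j → ≈-trans (*-congˡ (x≈0 j)) (zeroʳ _))

  ·ᵥ-lin : ∀ A x y c r → (A ·ᵥ (λ j → x j +ᶠ c *ᶠ y j)) r ≈ (A ·ᵥ x) r +ᶠ c *ᶠ (A ·ᵥ y) r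
  ·ᵥ-lin A x y c r = begin
    Σᶠ b (λ j → A r j *ᶠ (x j +ᶠ c *ᶠ y j))          ≈⟨ Σ-cong b (λ j → distribˡ _ _ _) ⟩
    Σᶠ b (λ j → A r j *ᶠ x j +ᶠ A r j *ᶠ (c *ᶠ y j)) ≈⟨ Σ-+ b _ _ ⟩
    (A ·ᵥ x) r +ᶠ Σᶠ b (λ j → A r j *ᶠ (c *ᶠ y j))   ≈⟨ +-congˡ (Σ-cong b (λ j → x*[c*y]≈c*[x*y] _ _ _)) ⟩
    (A ·ᵥ x) r +ᶠ Σᶠ b (λ j → c *ᶠ (A r j *ᶠ y j))   ≈⟨ +-congˡ (Σ-*ˡ b c _) ⟩
    (A ·ᵥ x) r +ᶠ c *ᶠ (A ·ᵥ y) r                    ∎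
    where
      x*[c*y]≈c*[x*y] : ∀ x c y → x *ᶠ (c *ᶠ y) ≈ c *ᶠ (x *ᶠ y)
      x*[c*y]≈c*[x*y] x c y = ≈-trans (≈-sym (*-assoc x c y)) (≈-trans (*-congʳ (*-comm x c)) (*-assoc c x y))

  unit : ℕ → Vector b
  unit n j = δ (toℕ j) n

  ·ᵥ-unit : ∀ A n (n<b : n < b) r → (A ·ᵥ unit n) r ≈ A r (fromℕ< n<b)
  ·ᵥ-unit A n n<b r = Σ-δ b n n<b (A r)

  I≈δ : ∀ (r s : Fin b) → I r s ≈ δ (toℕ r) (toℕ s)
  I≈δ r s with r Fin.≟ s
  ... | yes refl = ≈-sym (δ-refl (toℕ r))
  ... | no r≢s   = ≈-sym (δ-≢ (r≢s ∘ FinP.toℕ-injective))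

  I·ᵥ : ∀ x r → (I ·ᵥ x) r ≈ x r
  I·ᵥ x r = begin
    Σᶠ b (λ j → I r j *ᶠ x j)           ≈⟨ Σ-cong b (λ j → ≈-trans (*-comm _ _)
                                              (*-congˡ (≈-trans (I≈δ r j) (≈-reflexive (δ-sym (toℕ r) (toℕ j)))))) ⟩
    Σᶠ b (λ j → x j *ᶠ δ (toℕ j) (toℕ r)) ≈⟨ Σ-δ b (toℕ r) (FinP.toℕ<n r) x ⟩
    x (fromℕ< (FinP.toℕ<n r))          ≈⟨ ≈-reflexive (cong x (FinP.fromℕ<-toℕ r (FinP.toℕ<n r))) ⟩
    x r                                ∎

  ⊗-I : ∀ (A : Matrix b b) r s → (A ⊗ I) r s ≈ A r s
  ⊗-I A r s = begin
    Σᶠ b (λ j → A r j *ᶠ I j s)              ≈⟨ Σ-cong b (λ j → *-congˡ (I≈δ j s)) ⟩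
    Σᶠ b (λ j → A r j *ᶠ δ (toℕ j) (toℕ s))  ≈⟨ ·ᵥ-unit A (toℕ s) (FinP.toℕ<n s) r ⟩
    A r (fromℕ< (FinP.toℕ<n s))              ≈⟨ ≈-reflexive (cong (A r) (FinP.fromℕ<-toℕ s (FinP.toℕ<n s))) ⟩
    A r s                                    ∎

  columnStream : Matrix b b → Stream
  columnStream A n with n ℕ.<? b
  ... | yes n<b = λ r → A r (fromℕ< n<b)
  ... | no  _   = 0ᵥ

  columnStream-lists : ∀ A r j → A r j ≈ columnStream A (toℕ j) r
  columnStream-lists A r j with toℕ j ℕ.<? b
  ... | yes j<b = ≈-reflexive (cong (A r) (sym (FinP.fromℕ<-toℕ j j<b)))
  ... | no  j≮b = ⊥-elim (j≮b (FinP.toℕ<n j))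

  columnStream-< : ∀ A n (n<b : n < b) r → columnStream A n r ≈ A r (fromℕ< n<b)
  columnStream-< A n n<b r = ≈-trans (≈-reflexive (cong (λ m → columnStream A m r) (sym (FinP.toℕ-fromℕ< n<b))))
                                     (≈-sym (columnStream-lists A r (fromℕ< n<b)))

  isPivot≡pivotAt-columnStream : ∀ A i → isPivot A i ≡ pivotAt (columnStream A) (toℕ i)
  isPivot≡pivotAt-columnStream A = isPivot≡pivotAt A (columnStream A) (columnStream-lists A)

  prefix-combination : ∀ A n → n ≤ b → ∀ v → spanned (columnsBefore (columnStream A) n) v ≡ true →
                       Σ (Vector b) λ x → (∀ j → n ≤ toℕ j → x j ≈ 0#) × (∀ r → (A ·ᵥ x) r ≈ v r)
  prefix-combination A zero    _   v e = 0ᵥ , (λ _ _ → ≈-refl) ,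
    (λ r → ≈-trans (·ᵥ-zero A 0ᵥ (λ _ → ≈-refl) r) (≈-sym (vecEq-true {u = v} e r)))
  prefix-combination A (suc n) n<b v e with span-elim (columnStream A n) (columnsBefore (columnStream A) n) v e
  ... | t , ht with prefix-combination A n (ℕP.<⇒≤ n<b) _ ht
  ...   | x , x-support , Ax≈v-tu = x' , x'-support , Ax'≈v
    where
      x' : Vector b
      x' j = x j +ᶠ t *ᶠ unit n j
      x'-support : ∀ j → suc n ≤ toℕ j → x' j ≈ 0#
      x'-support j n<j = begin
        x j +ᶠ t *ᶠ unit n j ≈⟨ +-cong (x-support j (ℕP.<⇒≤ n<j)) (*-congˡ (δ-≢ (ℕP.>⇒≢ n<j))) ⟩
        0# +ᶠ t *ᶠ 0#        ≈⟨ +-identityˡ _ ⟩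
        t *ᶠ 0#              ≈⟨ zeroʳ t ⟩
        0#                   ∎
      Ax'≈v : ∀ r → (A ·ᵥ x') r ≈ v r
      Ax'≈v r = begin
        (A ·ᵥ x') r                                       ≈⟨ ·ᵥ-lin A x (unit n) t r ⟩
        (A ·ᵥ x) r +ᶠ t *ᶠ (A ·ᵥ unit n) r                ≈⟨ +-cong (Ax≈v-tu r) (*-congˡ (≈-trans (·ᵥ-unit A n n<b r)
                                                                                   (≈-sym (columnStream-< A n n<b r)))) ⟩
        (v r -ᶠ t *ᶠ columnStream A n r) +ᶠ t *ᶠ columnStream A n r ≈⟨ x-y+y≈x _ _ ⟩
        v r                                               ∎

  Injective : Matrix b b → Set _
  Injective A = ∀ (y : Vector b) → (∀ r → (A ·ᵥ y) r ≈ 0#) → ∀ j → y j ≈ 0#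

  -1≉0 : ¬ (-ᶠ 1# ≈ 0#)
  -1≉0 -1≈0 = 0≉1 (≈-sym (≈-trans (≈-sym (-‿involutive 1#)) (≈-trans (-‿cong -1≈0) -0#≈0#)))

  -- a non-pivot column i is a combination of earlier ones: x − unit i ≠ 0 is in the kernel
  injective⇒pivots : ∀ A → Injective A → ∀ i → isPivot A i ≡ true
  injective⇒pivots A inj i with isPivot A i in pivot?
  ... | true  = refl
  ... | false = ⊥-elim (-1≉0 (≈-trans (≈-sym yi≈-1) (inj y Ay≈0 i)))
    where
      n = toℕ i
      n<b = FinP.toℕ<n i
      u = columnStream A
      spanned-n : spanned (columnsBefore u n) (u n) ≡ true
      spanned-n = trans (sym (BoolP.not-involutive _))
                        (cong not (trans (sym (isPivot≡pivotAt-columnStream A i)) pivot?))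
      combination = prefix-combination A n (ℕP.<⇒≤ n<b) (u n) spanned-n
      x = proj₁ combination
      y : Vector b
      y j = x j +ᶠ (-ᶠ 1#) *ᶠ unit n j
      Ay≈0 : ∀ r → (A ·ᵥ y) r ≈ 0#
      Ay≈0 r = begin
        (A ·ᵥ y) r                                ≈⟨ ·ᵥ-lin A x (unit n) (-ᶠ 1#) r ⟩
        (A ·ᵥ x) r +ᶠ (-ᶠ 1#) *ᶠ (A ·ᵥ unit n) r   ≈⟨ +-cong (proj₂ (proj₂ combination) r)
                                                       (*-congˡ (≈-trans (·ᵥ-unit A n n<b r) (≈-sym (columnStream-< A n n<b r)))) ⟩
        u n r +ᶠ (-ᶠ 1#) *ᶠ u n r                  ≈⟨ +-congˡ (-1*x≈-x _) ⟩
        u n r -ᶠ u n r                            ≈⟨ -‿inverseʳ _ ⟩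
        0#                                        ∎
      yi≈-1 : y i ≈ -ᶠ 1#
      yi≈-1 = begin
        x i +ᶠ (-ᶠ 1#) *ᶠ unit n i ≈⟨ +-cong (proj₁ (proj₂ combination) i ℕP.≤-refl) (*-congˡ (δ-refl n)) ⟩
        0# +ᶠ (-ᶠ 1#) *ᶠ 1#        ≈⟨ +-identityˡ _ ⟩
        (-ᶠ 1#) *ᶠ 1#              ≈⟨ *-identityʳ _ ⟩
        -ᶠ 1#                      ∎

  pivots⇒surjective : ∀ A → (∀ i → isPivot A i ≡ true) → ∀ v → Σ (Vector b) λ x → ∀ r → (A ·ᵥ x) r ≈ v r
  pivots⇒surjective A pivots v = proj₁ combination , proj₂ (proj₂ combination)
    where
      u = columnStream A
      fresh : ∀ n → n < b → spanned (columnsBefore u n) (u n) ≡ false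
      fresh n n<b = trans (sym (BoolP.not-involutive _)) (cong not (trans
        (cong (pivotAt u) (sym (FinP.toℕ-fromℕ< n<b)))
        (trans (sym (isPivot≡pivotAt-columnStream A (fromℕ< n<b))) (pivots (fromℕ< n<b)))))
      rank-prefix : ∀ n → n ≤ b → rank (columnsBefore u n) ≡ n
      rank-prefix zero    _   = refl
      rank-prefix (suc n) n<b rewrite fresh n n<b = cong suc (rank-prefix n (ℕP.<⇒≤ n<b))
      everything-spanned : ∑ (χ ∘ spanned (columnsBefore u b)) allVectors ≡ length allVectors
      everything-spanned = trans (span-count (columnsBefore u b))
                                 (trans (cong (q ^_) (rank-prefix b ℕP.≤-refl)) (sym length-allVectors))
      v-spanned : spanned (columnsBefore u b) v ≡ true
      v-spanned = full-count⇒all vecEq {allVectors} (vectors-enumerate b)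
        (λ x y → spanned-cong (columnsBefore u b) ∘ vecEq-true {u = x} {y}) everything-spanned v
      combination = prefix-combination A b ℕP.≤-refl v v-spanned

  pivots⇒right-inverse : ∀ A → (∀ i → isPivot A i ≡ true) → Σ (Matrix b b) λ X → ∀ r s → (A ⊗ X) r s ≈ I r s
  pivots⇒right-inverse A pivots = X , AX≈I
    where
      X : Matrix b b
      X r s = proj₁ (pivots⇒surjective A pivots (unit (toℕ s))) r
      AX≈I : ∀ r s → (A ⊗ X) r s ≈ I r s
      AX≈I r s = ≈-trans (proj₂ (pivots⇒surjective A pivots (unit (toℕ s))) r)
                         (≈-sym (I≈δ r s))

  left-inverse⇒injective : ∀ A B → (∀ r s → (B ⊗ A) r s ≈ I r s) → Injective A
  left-inverse⇒injective A B BA≈I y Ay≈0 j = begin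
    y j               ≈⟨ I·ᵥ y j ⟨
    (I ·ᵥ y) j        ≈⟨ ·ᵥ-cong (λ r s → ≈-sym (BA≈I r s)) (λ _ → ≈-refl) j ⟩
    ((B ⊗ A) ·ᵥ y) j  ≈⟨ ·ᵥ-assoc B A y j ⟩
    (B ·ᵥ (A ·ᵥ y)) j ≈⟨ ·ᵥ-zero B _ Ay≈0 j ⟩
    0#                ∎

  matEq-cong : ∀ {C C' D D' : Matrix b b} → (∀ r s → C r s ≈ C' r s) → (∀ r s → D r s ≈ D' r s) →
               matEq C D ≡ matEq C' D'
  matEq-cong {C} {C'} {D} {D'} C≈C' D≈D' = bool-⇔
    (λ e → matrixEq-intro {M = C'} {D'} (λ r s → ≈-trans (≈-sym (C≈C' r s))
                                              (≈-trans (matrixEq-true {M = C} {D} e r s) (D≈D' r s))))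
    (λ e → matrixEq-intro {M = C} {D} (λ r s → ≈-trans (C≈C' r s)
                                            (≈-trans (matrixEq-true {M = C'} {D'} e r s) (≈-sym (D≈D' r s)))))

  pivots⇒invertible : ∀ A → (∀ i → isPivot A i ≡ true) → isInvertible A ≡ true
  pivots⇒invertible A pivots = any-enumeration matrixEq {allMatrices b b} (matrices-enumerate b) respects X
    (∧-intro (matrixEq-intro {M = A ⊗ X} {I} AX≈I) (matrixEq-intro {M = X ⊗ A} {I} XA≈I))
    where
      two-sided : Matrix b b → Bool
      two-sided B = matEq (A ⊗ B) I ∧ matEq (B ⊗ A) I
      respects : ∀ B B' → matrixEq B B' ≡ true → two-sided B ≡ two-sided B'
      respects B B' e = cong₂ _∧_
        (matEq-cong {A ⊗ B} {A ⊗ B'} (λ r s → ·ᵥ-cong {A} (λ _ _ → ≈-refl) (λ k → B≈B' k s) r) (λ _ _ → ≈-refl))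
        (matEq-cong {B ⊗ A} {B' ⊗ A} (λ r s → ·ᵥ-cong B≈B' (λ _ → ≈-refl) r) (λ _ _ → ≈-refl))
        where B≈B' = matrixEq-true {M = B} {B'} e
      X = proj₁ (pivots⇒right-inverse A pivots)
      AX≈I = proj₂ (pivots⇒right-inverse A pivots)
      -- X has the left inverse A, so it is injective and has a right inverse Y; then Y = A
      X-pivots = injective⇒pivots X (left-inverse⇒injective X A AX≈I)
      Y = proj₁ (pivots⇒right-inverse X X-pivots)
      XY≈I = proj₂ (pivots⇒right-inverse X X-pivots)
      A≈Y : ∀ r s → A r s ≈ Y r s
      A≈Y r s = begin
        A r s                          ≈⟨ ⊗-I A r s ⟨
        (A ·ᵥ (λ k → I k s)) r         ≈⟨ ·ᵥ-cong {A} (λ _ _ → ≈-refl) (λ k → ≈-sym (XY≈I k s)) r ⟩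
        (A ·ᵥ (X ·ᵥ (λ k → Y k s))) r  ≈⟨ ·ᵥ-assoc A X _ r ⟨
        ((A ⊗ X) ·ᵥ (λ k → Y k s)) r   ≈⟨ ·ᵥ-cong AX≈I (λ _ → ≈-refl) r ⟩
        (I ·ᵥ (λ k → Y k s)) r         ≈⟨ I·ᵥ _ r ⟩
        Y r s                          ∎
      XA≈I : ∀ r s → (X ⊗ A) r s ≈ I r s
      XA≈I r s = ≈-trans (·ᵥ-cong {X} (λ _ _ → ≈-refl) (λ k → A≈Y k s) r) (XY≈I r s)

  invertible⇒pivots : ∀ A → isInvertible A ≡ true → ∀ i → isPivot A i ≡ true
  invertible⇒pivots A e with any-witness {p = λ B → matEq (A ⊗ B) I ∧ matEq (B ⊗ A) I} {allMatrices b b} e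
  ... | B , two-sided = injective⇒pivots A (left-inverse⇒injective A B
                          (matrixEq-true {M = B ⊗ A} {I} (proj₂ (∧-elim {matEq (A ⊗ B) I} two-sided))))

  isInvertible≡hasPivotSet : ∀ A → isInvertible A ≡ hasPivotSet (upTo b) A
  isInvertible≡hasPivotSet A = bool-⇔
    (λ e → all-allFin⁺ (λ i → trans (cong (isPivot A i ⇔ᵇ_) (∈⇒∈ᵇ (∈-upTo⁺ (FinP.toℕ<n i))))
                                    (trans (⇔ᵇ-true _) (invertible⇒pivots A e i))))
    (λ e → pivots⇒invertible A (λ i → trans (sym (⇔ᵇ-true _))
             (trans (cong (isPivot A i ⇔ᵇ_) (sym (∈⇒∈ᵇ (∈-upTo⁺ (FinP.toℕ<n i))))) (all-allFin⁻ e i))))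

  cardGL≡pivotCount : cardGL b ≡ pivotCount q b (upTo b) b
  cardGL≡pivotCount = begin-≡
    cardGL b                                      ≡⟨ count≡∑χ isInvertible (allMatrices b b) ⟩
    ∑ (χ ∘ isInvertible) (allMatrices b b)        ≡⟨ ∑-cong (allMatrices b b) (cong χ ∘ isInvertible≡hasPivotSet) ⟩
    ∑ (χ ∘ hasPivotSet (upTo b)) (allMatrices b b) ≡⟨ count≡∑χ (hasPivotSet (upTo b)) (allMatrices b b) ⟨
    countPivotSet b b (upTo b)                    ≡⟨ countPivotSet≡pivotCount b (upTo b) ⟩
    pivotCount q b (upTo b) b                     ∎-≡
    where open ≡-Reasoning renaming (begin_ to begin-≡_; _∎ to _∎-≡)

-- Arithmetic of the predicted count.  pivotCount q b τ N factors as
-- (q^b − 1)(q^b − q)⋯(q^b − q^(k−1)) · q^E with k = pivotsBelow τ N and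
-- E = Σ_{m < N, m ∉ τ} pivotsBelow τ m.  Double counting the pairs
-- (pivot, non-pivot) below N gives E + ℓ + k² = N·k, and for the full
-- juggling state k = b; this turns the count into the claimed formula.

∑∈below : List ℕ → (ℕ → ℕ) → ℕ → ℕ
∑∈below σ f zero    = 0
∑∈below σ f (suc N) = ∑∈below σ f N + (if N ∈ᵇ σ then f N else 0)

∑∈below-[] : ∀ f N → ∑∈below [] f N ≡ 0
∑∈below-[] f zero    = refl
∑∈below-[] f (suc N) = cong (_+ 0) (∑∈below-[] f N)

∑∈below-singleton-≥ : ∀ t f N → N ≤ t → ∑∈below (t ∷ []) f N ≡ 0
∑∈below-singleton-≥ t f zero    _   = refl
∑∈below-singleton-≥ t f (suc N) N<t rewrite ≡ᵇ-false t N (ℕP.>⇒≢ N<t) =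
  cong (_+ 0) (∑∈below-singleton-≥ t f N (ℕP.<⇒≤ N<t))

∑∈below-singleton-< : ∀ t f N → t < N → ∑∈below (t ∷ []) f N ≡ f t
∑∈below-singleton-< t f (suc N) (s≤s t≤N) with ℕP.m≤n⇒m<n∨m≡n t≤N
... | inj₁ t<N  rewrite ≡ᵇ-false t N (ℕP.<⇒≢ t<N) = trans (ℕP.+-identityʳ _) (∑∈below-singleton-< t f N t<N)
... | inj₂ refl rewrite ≡ᵇ-refl t = cong (_+ f t) (∑∈below-singleton-≥ t f t ℕP.≤-refl)

∑∈below-∷ : ∀ t σ f N → t ∈ᵇ σ ≡ false → ∑∈below (t ∷ σ) f N ≡ ∑∈below (t ∷ []) f N + ∑∈below σ f N
∑∈below-∷ t σ f zero    _    = refl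
∑∈below-∷ t σ f (suc N) t∉σ rewrite ∑∈below-∷ t σ f N t∉σ with t ≡ᵇ N in t≡N
... | true  rewrite sym (ℕP.≡ᵇ⇒≡ t N (subst T (sym t≡N) _)) | t∉σ =
  solve 3 (λ a s c → a :+ s :+ c := a :+ c :+ (s :+ con 0)) refl
    (∑∈below (t ∷ []) f t) (∑∈below σ f t) (f t)
... | false with N ∈ᵇ σ
...   | true  = solve 3 (λ a s c → a :+ s :+ c := a :+ con 0 :+ (s :+ c)) refl
                  (∑∈below (t ∷ []) f N) (∑∈below σ f N) (f N)
...   | false = solve 2 (λ a s → a :+ s :+ con 0 := a :+ con 0 :+ (s :+ con 0)) refl
                  (∑∈below (t ∷ []) f N) (∑∈below σ f N)

head∉tail : ∀ t σ → Linked _<_ (t ∷ σ) → t ∈ᵇ σ ≡ false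
head∉tail t []       _            = refl
head∉tail t (t' ∷ σ) (t<t' ∷ lnk) = below-head t<t' lnk
  where
    below-head : ∀ {m t σ} → m < t → Linked _<_ (t ∷ σ) → m ∈ᵇ (t ∷ σ) ≡ false
    below-head {m} {t} {[]}     m<t _ rewrite ≡ᵇ-false t m (ℕP.>⇒≢ m<t) = refl
    below-head {m} {t} {_ ∷ _} m<t (t<t' ∷ lnk) rewrite ≡ᵇ-false t m (ℕP.>⇒≢ m<t) =
      below-head (ℕP.<-trans m<t t<t') lnk

∑≡∑∈below : ∀ σ f N → Linked _<_ σ → All (_< N) σ → ∑ f σ ≡ ∑∈below σ f N
∑≡∑∈below []      f N _   _           = sym (∑∈below-[] f N)
∑≡∑∈below (t ∷ σ) f N lnk (t<N ∷ σ<N) = trans (cong (f t +_) (∑≡∑∈below σ f N (Linked.tail lnk) σ<N))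
  (sym (trans (∑∈below-∷ t σ f N (head∉tail t σ lnk)) (cong (_+ ∑∈below σ f N) (∑∈below-singleton-< t f N t<N))))

pivotsBelow≡∑∈below : ∀ τ N → pivotsBelow τ N ≡ ∑∈below τ (λ _ → 1) N
pivotsBelow≡∑∈below τ zero    = refl
pivotsBelow≡∑∈below τ (suc N) with N ∈ᵇ τ
... | true  = trans (cong suc (pivotsBelow≡∑∈below τ N)) (ℕP.+-comm 1 _)
... | false = trans (pivotsBelow≡∑∈below τ N) (sym (ℕP.+-identityʳ _))

nonPivotsBelow : List ℕ → ℕ → ℕ
nonPivotsBelow τ j = length (filter (λ i → not (i ∈ᵇ τ) BoolP.≟ true) (upTo j))

nonPivotsBelow-suc : ∀ τ N → nonPivotsBelow τ (suc N) ≡ nonPivotsBelow τ N + χ (not (N ∈ᵇ τ))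
nonPivotsBelow-suc τ N = begin
  nonPivotsBelow τ (suc N)                   ≡⟨ count≡∑χ notInτ (upTo (suc N)) ⟩
  ∑ (χ ∘ notInτ) (upTo (suc N))              ≡⟨ cong (∑ (χ ∘ notInτ)) (ListP.applyUpTo-∷ʳ (λ i → i) N) ⟨
  ∑ (χ ∘ notInτ) (upTo N ++ N ∷ [])          ≡⟨ cong sum (ListP.map-++ (χ ∘ notInτ) (upTo N) (N ∷ [])) ⟩
  sum (map (χ ∘ notInτ) (upTo N) ++ χ (notInτ N) ∷ [])
                                             ≡⟨ SumP.sum-++ (map (χ ∘ notInτ) (upTo N)) _ ⟩
  ∑ (χ ∘ notInτ) (upTo N) + (χ (notInτ N) + 0) ≡⟨ cong₂ _+_ (sym (count≡∑χ notInτ (upTo N))) (ℕP.+-identityʳ _) ⟩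
  nonPivotsBelow τ N + χ (notInτ N)          ∎
  where
    open ≡-Reasoning
    notInτ : ℕ → Bool
    notInτ i = not (i ∈ᵇ τ)

nonPivots+pivots : ∀ τ N → nonPivotsBelow τ N + pivotsBelow τ N ≡ N
nonPivots+pivots τ zero    = refl
nonPivots+pivots τ (suc N) rewrite nonPivotsBelow-suc τ N with N ∈ᵇ τ
... | true  = trans (cong (_+ suc (pivotsBelow τ N)) (ℕP.+-identityʳ _))
                    (trans (ℕP.+-suc _ _) (cong suc (nonPivots+pivots τ N)))
... | false = trans (cong (_+ pivotsBelow τ N) (ℕP.+-comm _ 1)) (cong suc (nonPivots+pivots τ N))

module ClosedForm (q b : ℕ) where

  independentTuples : ℕ → ℕ
  independentTuples zero    = 1
  independentTuples (suc k) = independentTuples k * (q ^ b ∸ q ^ k)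

  -- Σ_{m < N, m ∉ τ} pivotsBelow τ m : the exponent collected by non-pivot columns
  gapExponent : List ℕ → ℕ → ℕ
  gapExponent τ zero    = 0
  gapExponent τ (suc N) = gapExponent τ N + (if N ∈ᵇ τ then 0 else pivotsBelow τ N)

  pivotCount-factors : ∀ τ N → pivotCount q b τ N ≡ independentTuples (pivotsBelow τ N) * q ^ gapExponent τ N
  pivotCount-factors τ zero    = refl
  pivotCount-factors τ (suc N) rewrite pivotCount-factors τ N with N ∈ᵇ τ
  ... | true  rewrite ℕP.+-identityʳ (gapExponent τ N) =
    solve 3 (λ a e d → a :* e :* d := a :* d :* e) refl
      (independentTuples (pivotsBelow τ N)) (q ^ gapExponent τ N) (q ^ b ∸ q ^ pivotsBelow τ N)
  ... | false rewrite ℕP.^-distribˡ-+-* q (gapExponent τ N) (pivotsBelow τ N) =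
    solve 3 (λ a e d → a :* e :* d := a :* (e :* d)) refl
      (independentTuples (pivotsBelow τ N)) (q ^ gapExponent τ N) (q ^ pivotsBelow τ N)

  -- double counting: with k = pivotsBelow τ N, the pairs (pivot, non-pivot)
  -- below N number k·(N − k), split according to which comes first
  pair-count : ∀ τ N → gapExponent τ N + ∑∈below τ (nonPivotsBelow τ) N + pivotsBelow τ N * pivotsBelow τ N
                       ≡ N * pivotsBelow τ N
  pair-count τ zero    = refl
  pair-count τ (suc N) with N ∈ᵇ τ | nonPivots+pivots τ N | pair-count τ N
  ... | true  | split | IH = begin
    E + 0 + (S + n) + suc k * suc k           ≡⟨ solve 4 (λ e s n k → e :+ con 0 :+ (s :+ n) :+ (con 1 :+ k) :* (con 1 :+ k)
                                                                 := (e :+ s :+ k :* k) :+ (n :+ k :+ k :+ con 1)) refl E S n k ⟩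
    (E + S + k * k) + (n + k + k + 1)         ≡⟨ cong₂ _+_ IH (cong (λ z → z + k + 1) split) ⟩
    N * k + (N + k + 1)                       ≡⟨ solve 2 (λ N k → N :* k :+ (N :+ k :+ con 1) := (con 1 :+ N) :* (con 1 :+ k)) refl N k ⟩
    suc N * suc k                             ∎
    where
      open ≡-Reasoning
      E = gapExponent τ N
      S = ∑∈below τ (nonPivotsBelow τ) N
      n = nonPivotsBelow τ N
      k = pivotsBelow τ N
  ... | false | _     | IH = begin
    E + k + (S + 0) + k * k                   ≡⟨ solve 3 (λ e s k → e :+ k :+ (s :+ con 0) :+ k :* k := k :+ (e :+ s :+ k :* k)) refl E S k ⟩
    k + (E + S + k * k)                       ≡⟨ cong (k +_) IH ⟩
    k + N * k                                 ∎
    where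
      open ≡-Reasoning
      E = gapExponent τ N
      S = ∑∈below τ (nonPivotsBelow τ) N
      k = pivotsBelow τ N

  pivotsBelow-upTo : ∀ n → n ≤ b → pivotsBelow (upTo b) n ≡ n
  pivotsBelow-upTo zero    _   = refl
  pivotsBelow-upTo (suc n) n<b rewrite ∈⇒∈ᵇ (∈-upTo⁺ n<b) = cong suc (pivotsBelow-upTo n (ℕP.<⇒≤ n<b))

  gapExponent-upTo : ∀ n → n ≤ b → gapExponent (upTo b) n ≡ 0
  gapExponent-upTo zero    _   = refl
  gapExponent-upTo (suc n) n<b rewrite ∈⇒∈ᵇ (∈-upTo⁺ n<b) = cong (_+ 0) (gapExponent-upTo n (ℕP.<⇒≤ n<b))

  pivotCount-full : pivotCount q b (upTo b) b ≡ independentTuples b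
  pivotCount-full rewrite pivotCount-factors (upTo b) b | pivotsBelow-upTo b ℕP.≤-refl
                        | gapExponent-upTo b ℕP.≤-refl = ℕP.*-identityʳ (independentTuples b)

  pivotCount-normalised : ∀ τ N → Linked _<_ τ → length τ ≡ b → All (_< N) τ →
    pivotCount q b τ N * q ^ (b * b) * q ^ ℓ τ ≡ pivotCount q b (upTo b) b * q ^ (b * N)
  pivotCount-normalised τ N sorted size bounded = begin
    pivotCount q b τ N * q ^ (b * b) * q ^ ℓ τ
      ≡⟨ cong₂ (λ x y → x * q ^ (b * b) * q ^ y) (pivotCount-factors τ N) ℓ≡S ⟩
    independentTuples k * q ^ E * q ^ (b * b) * q ^ S
      ≡⟨ cong (λ z → independentTuples z * q ^ E * q ^ (b * b) * q ^ S) k≡b ⟩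
    independentTuples b * q ^ E * q ^ (b * b) * q ^ S
      ≡⟨ solve 4 (λ p x y z → p :* x :* y :* z := p :* (x :* z :* y)) refl
           (independentTuples b) (q ^ E) (q ^ (b * b)) (q ^ S) ⟩
    independentTuples b * (q ^ E * q ^ S * q ^ (b * b))
      ≡⟨ cong (independentTuples b *_) (sym (trans (ℕP.^-distribˡ-+-* q (E + S) (b * b))
                                                   (cong (_* q ^ (b * b)) (ℕP.^-distribˡ-+-* q E S)))) ⟩
    independentTuples b * q ^ (E + S + b * b)
      ≡⟨ cong (λ z → independentTuples b * q ^ z) exponent ⟩
    independentTuples b * q ^ (b * N)
      ≡⟨ cong (_* q ^ (b * N)) pivotCount-full ⟨
    pivotCount q b (upTo b) b * q ^ (b * N) ∎
    where
      open ≡-Reasoning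
      k = pivotsBelow τ N
      E = gapExponent τ N
      S = ∑∈below τ (nonPivotsBelow τ) N
      k≡b : k ≡ b
      k≡b = trans (pivotsBelow≡∑∈below τ N)
                  (trans (sym (∑≡∑∈below τ (λ _ → 1) N sorted bounded)) (trans (sym (length≡∑1 τ)) size))
      ℓ≡S : ℓ τ ≡ S
      ℓ≡S = ∑≡∑∈below τ (nonPivotsBelow τ) N sorted bounded
      exponent : E + S + b * b ≡ b * N
      exponent = trans (cong (λ z → E + S + z * z) (sym k≡b))
                       (trans (pair-count τ N) (trans (cong (N *_) k≡b) (ℕP.*-comm N b)))

-- Both counts obey the column
-- recurrence, the invertible matrices being those with pivot set
-- {0, …, b-1}; the closed form of the recurrence then gives the identity.

proposition2p2 : ∀ {c l : Level} {q : ℕ} (F : FiniteField c l q) (b : ℕ) → 1 ≤ b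
    → (τ : JugglingState b) (N : ℕ) → All (_< N) (JugglingState.elems τ)
    → FiniteField.countPivotSet F b N (JugglingState.elems τ) * q ^ (b * b) * q ^ ℓ (JugglingState.elems τ)
      ≡ FiniteField.cardGL F b * q ^ (b * N)
proposition2p2 {q = q} F b _ τ N bounded = begin
  countPivotSet b N σ * q ^ (b * b) * q ^ ℓ σ
    ≡⟨ cong (λ n → n * q ^ (b * b) * q ^ ℓ σ) (countPivotSet≡pivotCount N σ) ⟩
  pivotCount q b σ N * q ^ (b * b) * q ^ ℓ σ
    ≡⟨ ClosedForm.pivotCount-normalised q b σ N (JugglingState.increasing τ) (JugglingState.size τ) bounded ⟩
  pivotCount q b (upTo b) b * q ^ (b * N)
    ≡⟨ cong (_* q ^ (b * N)) cardGL≡pivotCount ⟨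
  cardGL b * q ^ (b * N) ∎
  where
    open ≡-Reasoning
    open FiniteField F using (countPivotSet; cardGL)
    open MatrixBridge F b using (countPivotSet≡pivotCount)
    open GeneralLinear F b using (cardGL≡pivotCount)
    σ = JugglingState.elems τ
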